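{- For any integers $n\ge 1$ and $r\ge 0$, \[ \sum_{i=0}^{r}(-1)^{r-i}\binom{r}{i}\sum_{j=0}^{\infty}\frac{(-1)^{j}}{j!}w_{n,i+j}=\frac{r!}{e}\tilde{w}_{n,r} \quad\text{and}\quad \sum_{i=0}^{r}(-1)^{r-i}\binom{r}{i}\sum_{j=0}^{\infty}\frac{\tilde{\phi}_{n,j+i}}{2^{j+1}}=r!\,\tilde{w}_{n,r}. \] In particular, \[ \sum_{j=0}^{\infty}\frac{(-1)^{j}}{j!}w_{n,j}=\frac{1}{e}\tilde{w}_{n}\quad\text{and}\quad\sum_{j=0}^{\infty}\frac{\tilde{\phi}_{n,j}}{2^{j+1}}=\tilde{w}_{n}. \]
   Context: ${n\brace k}$ denotes the Stirling number of the second kind. For $s\ge 0$, the $s$-Stirling number of the second kind ${n+s\brace k+s}_s$ is the number of partitions of $\{1,\dots,n+s\}$ into $k+s$ nonempty blocks such that $1,\dots,s$ lie in distinct blocks (for $s=0$ these are the ordinary Stirling numbers). The $s$-ordered Bell numbers are $w_{n,s}=\sum_{k=0}^n{n+s\brace k+s}_s k!$; the $s$-exponential polynomials are $\phi_{n,s}(x)=\sum_{k=0}^n{n+s\brace k+s}_s x^k$, and $\tilde{\phi}_{n,s}=\phi_{n,s}(-1)$. $d_{k,r}$ is the number of permutations of a $k$-set with exactly $r$ fixed points ($d_{k,r}=\binom{k}{r}d_{k-r}$ for $k\ge r$, $0$ otherwise, $d_m=m!\sum_{i=0}^m(-1)^i/i!$), $\tilde{w}_{n,r}=\sum_{k=0}^n{n\brace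 k}d_{k,r}$, and $\tilde{w}_n=\tilde{w}_{n,0}$. -}

module Defs where

open import Data.Nat using (ℕ; zero; suc; _≤_; _!)
import Data.Nat as ℕ
open import Data.Nat.Properties using (_!≢0; m^n>0)
open import Data.Bool using (true; false)
open import Data.Nat.Combinatorics using (_C_)
open import Data.Integer using (ℤ; +_; -[1+_])
import Data.Integer as ℤ
open import Data.Rational using (ℚ; _/_; 0ℚ; _<_; ∣_∣)
import Data.Rational as ℚ
open import Data.Product using (∃-syntax)

Σℕ< : ℕ → (ℕ → ℕ) → ℕ
Σℕ< zero    f = 0
Σℕ< (suc n) f = Σℕ< n f ℕ.+ f n

Σℤ< : ℕ → (ℕ → ℤ) → ℤ
Σℤ< zero    f = + 0
Σℤ< (suc n) f = Σℤ< n f ℤ.+ f n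

Σℚ< : ℕ → (ℕ → ℚ) → ℚ
Σℚ< zero    f = 0ℚ
Σℚ< (suc n) f = Σℚ< n f ℚ.+ f n

sgn : ℕ → ℤ
sgn zero    = + 1
sgn (suc k) = ℤ.- sgn k

ℤ→ℚ : ℤ → ℚ
ℤ→ℚ z = z / 1

ℕ→ℚ : ℕ → ℚ
ℕ→ℚ n = (+ n) / 1

inv! : ℕ → ℚ
inv! k = (+ 1) / (k !) where instance _ = k !≢0

inv2^ : ℕ → ℚ
inv2^ k = (+ 1) / (2 ℕ.^ k) where instance _ = ℕ.>-nonZero (m^n>0 2 k)

-- s-Stirling numbers of the second kind.
-- sst s n k  =  {n+s brace k+s}_s : partitions of {1,…,n+s} into k+s
-- nonempty blocks with 1,…,s in distinct blocks.  Defined by the standard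
-- recurrence (insert the element n+s+1 into one of the k+s existing blocks,
-- or as a new singleton block).

sst : ℕ → ℕ → ℕ → ℕ
sst s zero    zero    = 1
sst s zero    (suc k) = 0
sst s (suc n) zero    = s ℕ.* sst s n zero
sst s (suc n) (suc k) = (suc k ℕ.+ s) ℕ.* sst s n (suc k) ℕ.+ sst s n k

stirling2 : ℕ → ℕ → ℕ
stirling2 n k = sst 0 n k

w : ℕ → ℕ → ℕ
w n s = Σℕ< (suc n) (λ k → sst s n k ℕ.* (k !))

-- s-exponential polynomials at x = -1:  φ̃_{n,s} = Σ_{k=0}^n {n+s brace k+s}_s (-1)^k
φ̃ : ℕ → ℕ → ℤ
φ̃ n s = Σℤ< (suc n) (λ k → sgn k ℤ.* (+ sst s n k))

-- derangement numbers d_m = m! Σ_{i=0}^m (-1)^i / i!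
der : ℕ → ℚ
der m = ℕ→ℚ (m !) ℚ.* Σℚ< (suc m) (λ i → ℤ→ℚ (sgn i) ℚ.* inv! i)

-- d_{k,r}: permutations of a k-set with exactly r fixed points
dfix : ℕ → ℕ → ℚ
dfix k r with r ℕ.≤ᵇ k
... | true  = ℕ→ℚ (k C r) ℚ.* der (k ℕ.∸ r)
... | false = 0ℚ

w̃r : ℕ → ℕ → ℚ
w̃r n r = Σℚ< (suc n) (λ k → ℕ→ℚ (stirling2 n k) ℚ.* dfix k r)

w̃ : ℕ → ℚ
w̃ n = w̃r n 0

ConvergesTo : (ℕ → ℚ) → ℚ → Set
ConvergesTo a L = ∀ (ε : ℚ) → 0ℚ < ε → ∃[ N ] (∀ m → N ≤ m → ∣ a m ℚ.- L ∣ < ε)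

IsCauchy : (ℕ → ℚ) → Set
IsCauchy a = ∀ (ε : ℚ) → 0ℚ < ε → ∃[ N ] (∀ m k → N ≤ m → N ≤ k → ∣ a m ℚ.- a k ∣ < ε)

SameLimit : (ℕ → ℚ) → (ℕ → ℚ) → Set
SameLimit a b = ConvergesTo (λ m → a m ℚ.- b m) 0ℚ

-- Partial sums of the series  Σ_j (-1)^j/j!  (whose sum is 1/e)
eInvPartial : ℕ → ℚ
eInvPartial M = Σℚ< M (λ k → ℤ→ℚ (sgn k) ℚ.* inv! k)

inner1 : ℕ → ℕ → ℕ → ℚ
inner1 n i M = Σℚ< M (λ j → ℤ→ℚ (sgn j) ℚ.* inv! j ℚ.* ℕ→ℚ (w n (i ℕ.+ j)))

inner2 : ℕ → ℕ → ℕ → ℚ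
inner2 n i M = Σℚ< M (λ j → ℤ→ℚ (φ̃ n (j ℕ.+ i)) ℚ.* inv2^ (suc j))

altBinom : ℕ → (ℕ → ℚ) → ℚ
altBinom r a = Σℚ< (suc r) (λ i → ℤ→ℚ (sgn (r ℕ.∸ i) ℤ.* + (r C i)) ℚ.* a i)

{-# OPTIONS --safe #-}

-- Put U s k = {n+s brace k+s}_s k!, so that w_{n,s} = Σ_k U s k. The recurrence of the s-Stirling
-- numbers gives Pascal's rule U (s+1) k = U s k + U s (k+1), and so does every row sum
-- T s m = Σ_k c_k U s (k+m). Hence T (i+j) 0 = Σ_l C(j,l) T i l, and the alternating binomial sum,
-- which inverts these forward differences, gives Σ_i (-1)^(r-i) C(r,i) T i l = T 0 (l+r).
-- Exchanging the finite l-sum with the j-series leaves the exact partial sums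
-- Σ_{j<M} C(j,l) (-1)^j/j! = (-1)^l/l! Σ_{j<M-l} (-1)^j/j! and Σ_{j<M} C(j,l)/2^(j+1) = 1 - Σ_{t≤l} C(M,t)/2^M,
-- which behave like (-1)^l/l! e⁻¹ and 1. What remains is Σ_l (-1)^l/l! Σ_k U 0 (k+l+r), and this is
-- r! w̃_{n,r} because d_p = p! Σ_{i≤p} (-1)^i/i!.

module Submission where

open import Defs
open import Data.Nat as ℕ using (ℕ; zero; suc; _!; _≤_; z≤n; s≤s)
import Data.Nat.Properties as ℕP
open import Data.Nat.Properties using (_!*_!≢0)
open import Data.Nat.Combinatorics
  using (_C_; nCk≡n!/k![n-k]!; k![n∸k]!∣n!; nCk+nC[k+1]≡[n+1]C[k+1]; k>n⇒nCk≡0; [n-k]*[n-k-1]!≡[n-k]!)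
open import Data.Nat.Coprimality as Coprimality using (Coprime; 1-coprimeTo)
open import Data.Nat.DivMod using (m/n*n≡m)
open import Data.Nat.Tactic.RingSolver using (solve-∀)
open import Data.Integer as ℤ using (ℤ; +_; -[1+_]; +[1+_])
import Data.Integer.Properties as ℤP
open import Data.Rational as ℚ using (ℚ; mkℚ; _/_; 0ℚ; 1ℚ; _+_; _*_; -_; _-_; ∣_∣)
import Data.Rational.Properties as ℚP
open import Data.Rational.Solver using (module +-*-Solver)
open +-*-Solver using (solve; _:+_; _:*_; _:-_; :-_; _:=_; con)
open import Data.Bool using (true; false)
open import Data.Unit using (tt)
open import Data.Empty using (⊥-elim)
open import Data.Product using (∃-syntax; _,_; _×_)
open import Relation.Binary.PropositionalEquality
open import Relation.Nullary using (yes; no)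

private
  coprime-to-1 : ∀ z → Coprime ℤ.∣ z ∣ 1
  coprime-to-1 z = Coprimality.sym (1-coprimeTo _)

ℤ→ℚ≡mkℚ : ∀ z → ℤ→ℚ z ≡ mkℚ z 0 (coprime-to-1 z)
ℤ→ℚ≡mkℚ z = ℚP.↥p/↧p≡p (mkℚ z 0 (coprime-to-1 z))

ℤ→ℚ-+ : ∀ a b → ℤ→ℚ (a ℤ.+ b) ≡ ℤ→ℚ a + ℤ→ℚ b
ℤ→ℚ-+ a b = begin
  (a ℤ.+ b) / 1
    ≡⟨ ℚP./-cong {a ℤ.+ b} {1} {_} {1} (sym (cong₂ ℤ._+_ (ℤP.*-identityʳ a) (ℤP.*-identityʳ b))) refl ⟩
  (a ℤ.* + 1 ℤ.+ b ℤ.* + 1) / (1 ℕ.* 1)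
    ≡⟨ sym (cong₂ _+_ (ℤ→ℚ≡mkℚ a) (ℤ→ℚ≡mkℚ b)) ⟩
  ℤ→ℚ a + ℤ→ℚ b ∎
  where open ≡-Reasoning

ℤ→ℚ-* : ∀ a b → ℤ→ℚ (a ℤ.* b) ≡ ℤ→ℚ a * ℤ→ℚ b
ℤ→ℚ-* a b = sym (cong₂ _*_ (ℤ→ℚ≡mkℚ a) (ℤ→ℚ≡mkℚ b))

ℤ→ℚ-neg : ∀ z → ℤ→ℚ (ℤ.- z) ≡ - ℤ→ℚ z
ℤ→ℚ-neg z = trans (ℤ→ℚ≡mkℚ (ℤ.- z)) (trans (mkℚ-neg z) (cong -_ (sym (ℤ→ℚ≡mkℚ z))))
  where
  mkℚ-neg : ∀ z → mkℚ (ℤ.- z) 0 (coprime-to-1 (ℤ.- z)) ≡ - mkℚ z 0 (coprime-to-1 z)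
  mkℚ-neg -[1+ n ]   = refl
  mkℚ-neg (+ zero)   = refl
  mkℚ-neg +[1+ n ]   = refl

ℤ→ℚ-sub : ∀ a b → ℤ→ℚ (a ℤ.- b) ≡ ℤ→ℚ a - ℤ→ℚ b
ℤ→ℚ-sub a b = trans (ℤ→ℚ-+ a (ℤ.- b)) (cong (λ x → ℤ→ℚ a + x) (ℤ→ℚ-neg b))

ℕ→ℚ-+ : ∀ a b → ℕ→ℚ (a ℕ.+ b) ≡ ℕ→ℚ a + ℕ→ℚ b
ℕ→ℚ-+ a b = ℤ→ℚ-+ (+ a) (+ b)

ℕ→ℚ-* : ∀ a b → ℕ→ℚ (a ℕ.* b) ≡ ℕ→ℚ a * ℕ→ℚ b
ℕ→ℚ-* a b = trans (cong ℤ→ℚ (ℤP.pos-* a b)) (ℤ→ℚ-* (+ a) (+ b))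

ℕ→ℚ-mono-≤ : ∀ {a b} → a ℕ.≤ b → ℕ→ℚ a ℚ.≤ ℕ→ℚ b
ℕ→ℚ-mono-≤ {a} {b} a≤b rewrite ℤ→ℚ≡mkℚ (+ a) | ℤ→ℚ≡mkℚ (+ b) =
  ℚ.*≤* (subst₂ ℤ._≤_ (sym (ℤP.*-identityʳ (+ a))) (sym (ℤP.*-identityʳ (+ b))) (ℤ.+≤+ a≤b))

ℕ→ℚ-nonNeg : ∀ d → ℚ.NonNegative (ℕ→ℚ d)
ℕ→ℚ-nonNeg d = ℚP.normalize-nonNeg d 1

ℕ→ℚ-pos : ∀ d .{{_ : ℕ.NonZero d}} → ℚ.Positive (ℕ→ℚ d)
ℕ→ℚ-pos d = ℚP.normalize-pos d 1

inv : (d : ℕ) → .{{ℕ.NonZero d}} → ℚ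
inv d = (+ 1) / d

inv-nonNeg : ∀ d .{{_ : ℕ.NonZero d}} → ℚ.NonNegative (inv d)
inv-nonNeg d = ℚP.normalize-nonNeg 1 d

ℕ→ℚ*inv≡1 : ∀ d .{{_ : ℕ.NonZero d}} → ℕ→ℚ d * inv d ≡ 1ℚ
ℕ→ℚ*inv≡1 (suc m) =
  trans (cong₂ _*_ (ℤ→ℚ≡mkℚ (+ suc m)) (ℚP.↥p/↧p≡p (mkℚ (+ 1) m (1-coprimeTo _))))
        (ℚP.*-inverseʳ (mkℚ (+ suc m) 0 (coprime-to-1 (+ suc m))))

ℕ→ℚ*inv!≡1 : ∀ k → ℕ→ℚ (k !) * inv! k ≡ 1ℚ
ℕ→ℚ*inv!≡1 k = ℕ→ℚ*inv≡1 (k !) {{k ℕP.!≢0}}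

2^≢0 : ∀ k → ℕ.NonZero (2 ℕ.^ k)
2^≢0 k = ℕ.>-nonZero (ℕP.m^n>0 2 k)

ℕ→ℚ*inv2^≡1 : ∀ k → ℕ→ℚ (2 ℕ.^ k) * inv2^ k ≡ 1ℚ
ℕ→ℚ*inv2^≡1 k = ℕ→ℚ*inv≡1 (2 ℕ.^ k) {{2^≢0 k}}

ℕ→ℚ-*-cancelˡ : ∀ a .{{_ : ℕ.NonZero a}} x y → ℕ→ℚ a * x ≡ ℕ→ℚ a * y → x ≡ y
ℕ→ℚ-*-cancelˡ a x y eq = trans (sym (unit x)) (trans (cong (inv a *_) eq) (unit y))
  where
  unit : ∀ z → inv a * (ℕ→ℚ a * z) ≡ z
  unit z = begin
    inv a * (ℕ→ℚ a * z) ≡⟨ sym (ℚP.*-assoc (inv a) (ℕ→ℚ a) z) ⟩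
    inv a * ℕ→ℚ a * z   ≡⟨ cong (_* z) (trans (ℚP.*-comm (inv a) (ℕ→ℚ a)) (ℕ→ℚ*inv≡1 a)) ⟩
    1ℚ * z              ≡⟨ ℚP.*-identityˡ z ⟩
    z                   ∎
    where open ≡-Reasoning

frac-mono-≤ : ∀ a b c d .{{_ : ℕ.NonZero b}} .{{_ : ℕ.NonZero d}} → a ℕ.* d ℕ.≤ c ℕ.* b →
              ℕ→ℚ a * inv b ℚ.≤ ℕ→ℚ c * inv d
frac-mono-≤ a b c d ad≤cb = ℚP.*-cancelʳ-≤-pos (ℕ→ℚ (b ℕ.* d)) {{ℕ→ℚ-pos (b ℕ.* d) {{ℕP.m*n≢0 b d}}}} (begin
  ℕ→ℚ a * inv b * ℕ→ℚ (b ℕ.* d) ≡⟨ clear a b d ⟩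
  ℕ→ℚ a * ℕ→ℚ d                 ≡⟨ sym (ℕ→ℚ-* a d) ⟩
  ℕ→ℚ (a ℕ.* d)                 ≤⟨ ℕ→ℚ-mono-≤ ad≤cb ⟩
  ℕ→ℚ (c ℕ.* b)                 ≡⟨ ℕ→ℚ-* c b ⟩
  ℕ→ℚ c * ℕ→ℚ b                 ≡⟨ sym (clear c d b) ⟩
  ℕ→ℚ c * inv d * ℕ→ℚ (d ℕ.* b) ≡⟨ cong (λ m → ℕ→ℚ c * inv d * ℕ→ℚ m) (ℕP.*-comm d b) ⟩
  ℕ→ℚ c * inv d * ℕ→ℚ (b ℕ.* d) ∎)
  where
  open ℚP.≤-Reasoning
  clear : ∀ x y z .{{_ : ℕ.NonZero y}} → ℕ→ℚ x * inv y * ℕ→ℚ (y ℕ.* z) ≡ ℕ→ℚ x * ℕ→ℚ z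
  clear x y z = begin-equality
    ℕ→ℚ x * inv y * ℕ→ℚ (y ℕ.* z)   ≡⟨ cong (ℕ→ℚ x * inv y *_) (ℕ→ℚ-* y z) ⟩
    ℕ→ℚ x * inv y * (ℕ→ℚ y * ℕ→ℚ z) ≡⟨ solve 4 (λ x i y z → x :* i :* (y :* z) := x :* z :* (y :* i)) refl
                                             (ℕ→ℚ x) (inv y) (ℕ→ℚ y) (ℕ→ℚ z) ⟩
    ℕ→ℚ x * ℕ→ℚ z * (ℕ→ℚ y * inv y) ≡⟨ cong (ℕ→ℚ x * ℕ→ℚ z *_) (ℕ→ℚ*inv≡1 y) ⟩
    ℕ→ℚ x * ℕ→ℚ z * 1ℚ              ≡⟨ ℚP.*-identityʳ _ ⟩
    ℕ→ℚ x * ℕ→ℚ z                   ∎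

Σ-cong< : ∀ N {f g : ℕ → ℚ} → (∀ i → i ℕ.< N → f i ≡ g i) → Σℚ< N f ≡ Σℚ< N g
Σ-cong< zero    f≡g = refl
Σ-cong< (suc N) f≡g = cong₂ _+_ (Σ-cong< N (λ i i<N → f≡g i (ℕP.m<n⇒m<1+n i<N))) (f≡g N ℕP.≤-refl)

Σ-cong : ∀ N {f g : ℕ → ℚ} → (∀ i → f i ≡ g i) → Σℚ< N f ≡ Σℚ< N g
Σ-cong N f≡g = Σ-cong< N (λ i _ → f≡g i)

Σ-vanish : ∀ N {f : ℕ → ℚ} → (∀ i → i ℕ.< N → f i ≡ 0ℚ) → Σℚ< N f ≡ 0ℚ
Σ-vanish zero    f≡0 = refl
Σ-vanish (suc N) f≡0 = cong₂ _+_ (Σ-vanish N (λ i i<N → f≡0 i (ℕP.m<n⇒m<1+n i<N))) (f≡0 N ℕP.≤-refl)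

Σ-distrib-+ : ∀ N (f g : ℕ → ℚ) → Σℚ< N (λ i → f i + g i) ≡ Σℚ< N f + Σℚ< N g
Σ-distrib-+ zero    f g = refl
Σ-distrib-+ (suc N) f g = trans (cong (_+ (f N + g N)) (Σ-distrib-+ N f g))
  (solve 4 (λ a b c d → (a :+ b) :+ (c :+ d) := (a :+ c) :+ (b :+ d)) refl (Σℚ< N f) (Σℚ< N g) (f N) (g N))

Σ-distrib-neg : ∀ N (f : ℕ → ℚ) → - Σℚ< N f ≡ Σℚ< N (λ i → - f i)
Σ-distrib-neg zero    f = refl
Σ-distrib-neg (suc N) f = trans (ℚP.neg-distrib-+ (Σℚ< N f) (f N)) (cong (_+ - f N) (Σ-distrib-neg N f))

Σ-distrib-sub : ∀ N (f g : ℕ → ℚ) → Σℚ< N (λ i → f i - g i) ≡ Σℚ< N f - Σℚ< N g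
Σ-distrib-sub N f g = trans (Σ-distrib-+ N f (λ i → - g i)) (cong (λ x → Σℚ< N f + x) (sym (Σ-distrib-neg N g)))

*-distribˡ-Σ : ∀ N c (f : ℕ → ℚ) → c * Σℚ< N f ≡ Σℚ< N (λ i → c * f i)
*-distribˡ-Σ zero    c f = ℚP.*-zeroʳ c
*-distribˡ-Σ (suc N) c f = trans (ℚP.*-distribˡ-+ c (Σℚ< N f) (f N)) (cong (_+ c * f N) (*-distribˡ-Σ N c f))

*-distribʳ-Σ : ∀ N c (f : ℕ → ℚ) → Σℚ< N f * c ≡ Σℚ< N (λ i → f i * c)
*-distribʳ-Σ N c f = trans (ℚP.*-comm (Σℚ< N f) c) (trans (*-distribˡ-Σ N c f) (Σ-cong N (λ i → ℚP.*-comm c (f i))))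

Σ-suc : ∀ N (f : ℕ → ℚ) → Σℚ< (suc N) f ≡ f 0 + Σℚ< N (λ i → f (suc i))
Σ-suc zero    f = trans (ℚP.+-identityˡ (f 0)) (sym (ℚP.+-identityʳ (f 0)))
Σ-suc (suc N) f = trans (cong (_+ f (suc N)) (Σ-suc N f)) (ℚP.+-assoc (f 0) _ _)

Σ-split : ∀ a b (f : ℕ → ℚ) → Σℚ< (a ℕ.+ b) f ≡ Σℚ< a f + Σℚ< b (λ i → f (a ℕ.+ i))
Σ-split a zero    f = trans (cong (λ m → Σℚ< m f) (ℕP.+-identityʳ a)) (sym (ℚP.+-identityʳ _))
Σ-split a (suc b) f = trans (cong (λ m → Σℚ< m f) (ℕP.+-suc a b))
  (trans (cong (_+ f (a ℕ.+ b)) (Σ-split a b f)) (ℚP.+-assoc (Σℚ< a f) _ _))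

Σ-extend : ∀ N m (f : ℕ → ℚ) → (∀ i → f (N ℕ.+ i) ≡ 0ℚ) → Σℚ< (N ℕ.+ m) f ≡ Σℚ< N f
Σ-extend N m f f≡0 = trans (Σ-split N m f) (trans (cong (λ x → Σℚ< N f + x) (Σ-vanish m (λ i _ → f≡0 i))) (ℚP.+-identityʳ _))

Σ-drop : ∀ r N (f : ℕ → ℚ) → (∀ i → i ℕ.< r → f i ≡ 0ℚ) → Σℚ< (r ℕ.+ N) f ≡ Σℚ< N (λ i → f (r ℕ.+ i))
Σ-drop r N f f≡0 = trans (Σ-split r N f) (trans (cong (_+ Σℚ< N (λ i → f (r ℕ.+ i))) (Σ-vanish r f≡0)) (ℚP.+-identityˡ _))

Σ-comm : ∀ N M (f : ℕ → ℕ → ℚ) → Σℚ< N (λ i → Σℚ< M (f i)) ≡ Σℚ< M (λ j → Σℚ< N (λ i → f i j))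
Σ-comm zero    M f = sym (Σ-vanish M (λ _ _ → refl))
Σ-comm (suc N) M f = trans (cong (_+ Σℚ< M (f N)) (Σ-comm N M f))
  (sym (Σ-distrib-+ M (λ j → Σℚ< N (λ i → f i j)) (f N)))

Σ-triangle : ∀ N (a b : ℕ → ℚ) →
  Σℚ< N (λ p → b p * Σℚ< (suc p) a) ≡ Σℚ< N (λ l → a l * Σℚ< (N ℕ.∸ l) (λ k → b (l ℕ.+ k)))
Σ-triangle zero    a b = refl
Σ-triangle (suc N) a b = begin
  Σℚ< N (λ p → b p * Σℚ< (suc p) a) + b N * (Σℚ< N a + a N)
    ≡⟨ cong (_+ b N * (Σℚ< N a + a N)) (Σ-triangle N a b) ⟩
  Σℚ< N (λ l → a l * S N l) + b N * (Σℚ< N a + a N)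
    ≡⟨ solve 4 (λ t s x y → t :+ y :* (s :+ x) := (t :+ s :* y) :+ x :* y) refl
         (Σℚ< N (λ l → a l * S N l)) (Σℚ< N a) (a N) (b N) ⟩
  (Σℚ< N (λ l → a l * S N l) + Σℚ< N a * b N) + a N * b N
    ≡⟨ cong₂ _+_ (trans (cong (λ x → Σℚ< N (λ l → a l * S N l) + x) (*-distribʳ-Σ N (b N) a))
                        (sym (Σ-distrib-+ N (λ l → a l * S N l) (λ l → a l * b N))))
                 (cong (a N *_) (sym S-last)) ⟩
  Σℚ< N (λ l → a l * S N l + a l * b N) + a N * S (suc N) N
    ≡⟨ cong (_+ a N * S (suc N) N) (Σ-cong< N (λ l l<N → trans (sym (ℚP.*-distribˡ-+ (a l) _ _)) (cong (a l *_) (sym (S-suc l l<N))))) ⟩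
  Σℚ< N (λ l → a l * S (suc N) l) + a N * S (suc N) N ∎
  where
  open ≡-Reasoning
  S : ℕ → ℕ → ℚ
  S M l = Σℚ< (M ℕ.∸ l) (λ k → b (l ℕ.+ k))
  S-suc : ∀ l → l ℕ.< N → S (suc N) l ≡ S N l + b N
  S-suc l l<N = trans (cong (λ m → Σℚ< m (λ k → b (l ℕ.+ k))) (ℕP.+-∸-assoc 1 (ℕP.<⇒≤ l<N)))
                      (cong (λ x → S N l + b x) (ℕP.m+[n∸m]≡n (ℕP.<⇒≤ l<N)))
  S-last : S (suc N) N ≡ b N
  S-last = trans (cong (λ m → Σℚ< m (λ k → b (N ℕ.+ k))) (ℕP.m+n∸n≡m 1 N))
                 (trans (ℚP.+-identityˡ _) (cong b (ℕP.+-identityʳ N)))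

∣Σ∣≤Σ∣∣ : ∀ N (f : ℕ → ℚ) → ∣ Σℚ< N f ∣ ℚ.≤ Σℚ< N (λ i → ∣ f i ∣)
∣Σ∣≤Σ∣∣ zero    f = ℚP.≤-refl
∣Σ∣≤Σ∣∣ (suc N) f = ℚP.≤-trans (ℚP.∣p+q∣≤∣p∣+∣q∣ (Σℚ< N f) (f N)) (ℚP.+-monoˡ-≤ ∣ f N ∣ (∣Σ∣≤Σ∣∣ N f))

Σ-mono-≤ : ∀ N {f g : ℕ → ℚ} → (∀ i → f i ℚ.≤ g i) → Σℚ< N f ℚ.≤ Σℚ< N g
Σ-mono-≤ zero    f≤g = ℚP.≤-refl
Σ-mono-≤ (suc N) f≤g = ℚP.+-mono-≤ (Σ-mono-≤ N f≤g) (f≤g N)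

ℕ→ℚ-Σ : ∀ N (f : ℕ → ℕ) → ℕ→ℚ (Σℕ< N f) ≡ Σℚ< N (λ i → ℕ→ℚ (f i))
ℕ→ℚ-Σ zero    f = refl
ℕ→ℚ-Σ (suc N) f = trans (ℕ→ℚ-+ (Σℕ< N f) (f N)) (cong (_+ ℕ→ℚ (f N)) (ℕ→ℚ-Σ N f))

ℤ→ℚ-Σ : ∀ N (f : ℕ → ℤ) → ℤ→ℚ (Σℤ< N f) ≡ Σℚ< N (λ i → ℤ→ℚ (f i))
ℤ→ℚ-Σ zero    f = refl
ℤ→ℚ-Σ (suc N) f = trans (ℤ→ℚ-+ (Σℤ< N f) (f N)) (cong (_+ ℤ→ℚ (f N)) (ℤ→ℚ-Σ N f))

nCk*k!*[n∸k]!≡n! : ∀ {n k} → k ℕ.≤ n → (n C k) ℕ.* (k ! ℕ.* (n ℕ.∸ k) !) ≡ n !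
nCk*k!*[n∸k]!≡n! {n} {k} k≤n rewrite nCk≡n!/k![n-k]! k≤n = m/n*n≡m {{_}} (k![n∸k]!∣n! k≤n)

[m+n]Cm*m!*n!≡[m+n]! : ∀ m n → ((m ℕ.+ n) C m) ℕ.* (m ! ℕ.* n !) ≡ (m ℕ.+ n) !
[m+n]Cm*m!*n!≡[m+n]! m n = trans (cong (λ k → ((m ℕ.+ n) C m) ℕ.* (m ! ℕ.* k !)) (sym (ℕP.m+n∸m≡n m n)))
                                 (nCk*k!*[n∸k]!≡n! (ℕP.m≤m+n m n))

nCk*[n∸k]≡nC[k+1]*[k+1] : ∀ n k → (n C k) ℕ.* (n ℕ.∸ k) ≡ (n C suc k) ℕ.* suc k
nCk*[n∸k]≡nC[k+1]*[k+1] n k with k ℕP.<? n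
... | yes k<n = ℕP.*-cancelʳ-≡ _ _ (k ! ℕ.* (n ℕ.∸ suc k) !) {{k !* (n ℕ.∸ suc k) !≢0}} (begin
  (n C k) ℕ.* (n ℕ.∸ k) ℕ.* (k ! ℕ.* (n ℕ.∸ suc k) !)
    ≡⟨ reassoc₁ (n C k) (n ℕ.∸ k) (k !) ((n ℕ.∸ suc k) !) ⟩
  (n C k) ℕ.* (k ! ℕ.* ((n ℕ.∸ k) ℕ.* (n ℕ.∸ suc k) !))
    ≡⟨ cong (λ m → (n C k) ℕ.* (k ! ℕ.* m)) ([n-k]*[n-k-1]!≡[n-k]! k<n) ⟩
  (n C k) ℕ.* (k ! ℕ.* (n ℕ.∸ k) !)
    ≡⟨ nCk*k!*[n∸k]!≡n! (ℕP.<⇒≤ k<n) ⟩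
  n !
    ≡⟨ sym (nCk*k!*[n∸k]!≡n! k<n) ⟩
  (n C suc k) ℕ.* (suc k ℕ.* k ! ℕ.* (n ℕ.∸ suc k) !)
    ≡⟨ reassoc₂ (n C suc k) (suc k) (k !) ((n ℕ.∸ suc k) !) ⟩
  (n C suc k) ℕ.* suc k ℕ.* (k ! ℕ.* (n ℕ.∸ suc k) !) ∎)
  where
  open ≡-Reasoning
  reassoc₁ : ∀ a b c d → a ℕ.* b ℕ.* (c ℕ.* d) ≡ a ℕ.* (c ℕ.* (b ℕ.* d))
  reassoc₁ = solve-∀
  reassoc₂ : ∀ a b c d → a ℕ.* (b ℕ.* c ℕ.* d) ≡ a ℕ.* b ℕ.* (c ℕ.* d)
  reassoc₂ = solve-∀
... | no k≮n = begin
  (n C k) ℕ.* (n ℕ.∸ k)       ≡⟨ cong ((n C k) ℕ.*_) (ℕP.m≤n⇒m∸n≡0 (ℕP.≮⇒≥ k≮n)) ⟩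
  (n C k) ℕ.* 0               ≡⟨ ℕP.*-zeroʳ (n C k) ⟩
  0                           ≡⟨ cong (ℕ._* suc k) (sym (k>n⇒nCk≡0 (s≤s (ℕP.≮⇒≥ k≮n)))) ⟩
  (n C suc k) ℕ.* suc k       ∎
  where open ≡-Reasoning

nCk≤2^n : ∀ n k → n C k ℕ.≤ 2 ℕ.^ n
nCk≤2^n zero    zero    = ℕP.≤-refl
nCk≤2^n zero    (suc k) = z≤n
nCk≤2^n (suc n) zero    = ℕP.m^n>0 2 (suc n)
nCk≤2^n (suc n) (suc k) rewrite sym (nCk+nC[k+1]≡[n+1]C[k+1] n k) =
  ℕP.+-mono-≤ (nCk≤2^n n k) (ℕP.≤-trans (nCk≤2^n n (suc k)) (ℕP.m≤m+n (2 ℕ.^ n) 0))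

n≤n! : ∀ n → n ℕ.≤ n !
n≤n! zero    = z≤n
n≤n! (suc n) = ℕP.≤-trans (ℕP.≤-reflexive (sym (ℕP.*-identityʳ (suc n)))) (ℕP.*-monoʳ-≤ (suc n) (ℕP.1≤n! n))

2^n≤[1+n]! : ∀ n → 2 ℕ.^ n ℕ.≤ (suc n) !
2^n≤[1+n]! zero    = ℕP.≤-refl
2^n≤[1+n]! (suc n) = ℕP.*-mono-≤ (s≤s (s≤s (z≤n {n}))) (2^n≤[1+n]! n)

n<2^n : ∀ n → n ℕ.< 2 ℕ.^ n
n<2^n zero    = ℕP.≤-refl
n<2^n (suc n) = ℕP.≤-trans (ℕP.+-mono-≤ (ℕP.m^n>0 2 n) (n<2^n n))
                           (ℕP.≤-reflexive (cong (2 ℕ.^ n ℕ.+_) (sym (ℕP.+-identityʳ (2 ℕ.^ n)))))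

sst-vanish : ∀ s {n k} → n ℕ.< k → sst s n k ≡ 0
sst-vanish s {zero}  {suc k} _         = refl
sst-vanish s {suc n} {suc k} (s≤s n<k)
  rewrite sst-vanish s (ℕP.m<n⇒m<1+n n<k) | sst-vanish s n<k = cong (ℕ._+ 0) (ℕP.*-zeroʳ (k ℕ.+ s))

sst-suc : ∀ s n k → sst (suc s) n k ≡ sst s n k ℕ.+ suc k ℕ.* sst s n (suc k)
sst-suc s zero    zero    = refl
sst-suc s zero    (suc k) = sym (ℕP.*-zeroʳ (suc (suc k)))
sst-suc s (suc n) zero    rewrite sst-suc s n 0 = regroup s (sst s n 0) (sst s n 1)
  where
  regroup : ∀ s a b → suc s ℕ.* (a ℕ.+ 1 ℕ.* b) ≡ s ℕ.* a ℕ.+ 1 ℕ.* ((1 ℕ.+ s) ℕ.* b ℕ.+ a)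
  regroup = solve-∀
sst-suc s (suc n) (suc k) rewrite sst-suc s n (suc k) | sst-suc s n k =
  regroup k s (sst s n (suc k)) (sst s n (suc (suc k))) (sst s n k)
  where
  regroup : ∀ k s a b c → (suc k ℕ.+ suc s) ℕ.* (a ℕ.+ suc (suc k) ℕ.* b) ℕ.+ (c ℕ.+ suc k ℕ.* a)
                      ≡ ((suc k ℕ.+ s) ℕ.* a ℕ.+ c) ℕ.+ suc (suc k) ℕ.* ((suc (suc k) ℕ.+ s) ℕ.* b ℕ.+ a)
  regroup = solve-∀

sst*!-pascal : ∀ s n k → sst (suc s) n k ℕ.* k ! ≡ sst s n k ℕ.* k ! ℕ.+ sst s n (suc k) ℕ.* (suc k) !
sst*!-pascal s n k rewrite sst-suc s n k = regroup k (sst s n k) (sst s n (suc k)) (k !)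
  where
  regroup : ∀ k a b f → (a ℕ.+ suc k ℕ.* b) ℕ.* f ≡ a ℕ.* f ℕ.+ b ℕ.* (suc k ℕ.* f)
  regroup = solve-∀

-- Alternating binomial sums

altCoeff : ℕ → ℕ → ℚ
altCoeff r i = ℤ→ℚ (sgn (r ℕ.∸ i) ℤ.* + (r C i))

altBinom-zero : ∀ a → altBinom 0 a ≡ a 0
altBinom-zero a = solve 1 (λ x → con 0ℚ :+ con 1ℚ :* x := x) refl (a 0)

altCoeff-suc : ∀ r i → altCoeff (suc r) (suc i) ≡ altCoeff r i - altCoeff r (suc i)
altCoeff-suc r i = trans (cong ℤ→ℚ coeff) (ℤ→ℚ-sub (sgn (r ℕ.∸ i) ℤ.* + (r C i)) (sgn (r ℕ.∸ suc i) ℤ.* + (r C suc i)))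
  where
  -- When i ≥ r the sign is off, but then r C (1 + i) = 0.
  flip : sgn (r ℕ.∸ i) ℤ.* + (r C suc i) ≡ ℤ.- (sgn (r ℕ.∸ suc i) ℤ.* + (r C suc i))
  flip with i ℕP.<? r
  ... | yes i<r = trans (cong (λ m → sgn m ℤ.* + (r C suc i)) (ℕP.+-∸-assoc 1 i<r))
                        (sym (ℤP.neg-distribˡ-* (sgn (r ℕ.∸ suc i)) (+ (r C suc i))))
  ... | no i≮r rewrite k>n⇒nCk≡0 (s≤s (ℕP.≮⇒≥ i≮r)) =
    trans (ℤP.*-zeroʳ (sgn (r ℕ.∸ i))) (sym (cong ℤ.-_ (ℤP.*-zeroʳ (sgn (r ℕ.∸ suc i)))))
  coeff : sgn (r ℕ.∸ i) ℤ.* + (suc r C suc i)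
        ≡ sgn (r ℕ.∸ i) ℤ.* + (r C i) ℤ.- sgn (r ℕ.∸ suc i) ℤ.* + (r C suc i)
  coeff = begin
    sgn (r ℕ.∸ i) ℤ.* + (suc r C suc i)
      ≡⟨ cong (λ m → sgn (r ℕ.∸ i) ℤ.* + m) (sym (nCk+nC[k+1]≡[n+1]C[k+1] r i)) ⟩
    sgn (r ℕ.∸ i) ℤ.* (+ (r C i) ℤ.+ + (r C suc i))
      ≡⟨ ℤP.*-distribˡ-+ (sgn (r ℕ.∸ i)) (+ (r C i)) (+ (r C suc i)) ⟩
    sgn (r ℕ.∸ i) ℤ.* + (r C i) ℤ.+ sgn (r ℕ.∸ i) ℤ.* + (r C suc i)
      ≡⟨ cong (λ z → sgn (r ℕ.∸ i) ℤ.* + (r C i) ℤ.+ z) flip ⟩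
    sgn (r ℕ.∸ i) ℤ.* + (r C i) ℤ.- sgn (r ℕ.∸ suc i) ℤ.* + (r C suc i) ∎
    where open ≡-Reasoning

altCoeff-head : ∀ r → altCoeff (suc r) 0 ≡ - altCoeff r 0
altCoeff-head r = trans (cong ℤ→ℚ (sym (ℤP.neg-distribˡ-* (sgn r) (+ 1)))) (ℤ→ℚ-neg (sgn r ℤ.* + 1))

altCoeff-vanish : ∀ r → altCoeff r (suc r) ≡ 0ℚ
altCoeff-vanish r = cong ℤ→ℚ (trans (cong (λ m → sgn (r ℕ.∸ suc r) ℤ.* + m) (k>n⇒nCk≡0 {r} ℕP.≤-refl))
                                  (ℤP.*-zeroʳ (sgn (r ℕ.∸ suc r))))

altBinom-suc : ∀ r (a : ℕ → ℚ) → altBinom (suc r) a ≡ altBinom r (λ i → a (suc i) - a i)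
altBinom-suc r a = begin
  Σℚ< (suc (suc r)) (λ i → altCoeff (suc r) i * a i)
    ≡⟨ Σ-suc (suc r) (λ i → altCoeff (suc r) i * a i) ⟩
  altCoeff (suc r) 0 * a 0 + Σℚ< (suc r) (λ i → altCoeff (suc r) (suc i) * a (suc i))
    ≡⟨ cong₂ (λ x y → x * a 0 + y) (altCoeff-head r)
             (Σ-cong (suc r) (λ i → cong (_* a (suc i)) (altCoeff-suc r i))) ⟩
  - altCoeff r 0 * a 0 + Σℚ< (suc r) (λ i → (altCoeff r i - altCoeff r (suc i)) * a (suc i))
    ≡⟨ cong (λ x → - altCoeff r 0 * a 0 + x)
            (trans (Σ-cong (suc r) (λ i → distrib (altCoeff r i) (altCoeff r (suc i)) (a (suc i))))
                   (Σ-distrib-sub (suc r) (λ i → altCoeff r i * a (suc i)) (λ i → altCoeff r (suc i) * a (suc i)))) ⟩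
  - altCoeff r 0 * a 0 + (Σℚ< (suc r) (λ i → altCoeff r i * a (suc i)) - (D + altCoeff r (suc r) * a (suc r)))
    ≡⟨ cong (λ x → - altCoeff r 0 * a 0 + (Σℚ< (suc r) (λ i → altCoeff r i * a (suc i)) - (D + x * a (suc r))))
            (altCoeff-vanish r) ⟩
  - altCoeff r 0 * a 0 + (Σℚ< (suc r) (λ i → altCoeff r i * a (suc i)) - (D + 0ℚ * a (suc r)))
    ≡⟨ solve 5 (λ c x b d z → :- c :* x :+ (b :- (d :+ con 0ℚ :* z)) := b :- (c :* x :+ d)) refl
         (altCoeff r 0) (a 0) (Σℚ< (suc r) (λ i → altCoeff r i * a (suc i))) D (a (suc r)) ⟩
  Σℚ< (suc r) (λ i → altCoeff r i * a (suc i)) - (altCoeff r 0 * a 0 + D)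
    ≡⟨ cong (λ x → Σℚ< (suc r) (λ i → altCoeff r i * a (suc i)) - x) (sym (Σ-suc r (λ i → altCoeff r i * a i))) ⟩
  Σℚ< (suc r) (λ i → altCoeff r i * a (suc i)) - Σℚ< (suc r) (λ i → altCoeff r i * a i)
    ≡⟨ sym (Σ-distrib-sub (suc r) (λ i → altCoeff r i * a (suc i)) (λ i → altCoeff r i * a i)) ⟩
  Σℚ< (suc r) (λ i → altCoeff r i * a (suc i) - altCoeff r i * a i)
    ≡⟨ Σ-cong (suc r) (λ i → sym (distribˡ (altCoeff r i) (a (suc i)) (a i))) ⟩
  Σℚ< (suc r) (λ i → altCoeff r i * (a (suc i) - a i)) ∎
  where
  open ≡-Reasoning
  D = Σℚ< r (λ i → altCoeff r (suc i) * a (suc i))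
  distrib : ∀ x y z → (x - y) * z ≡ x * z - y * z
  distrib = solve 3 (λ x y z → (x :- y) :* z := x :* z :- y :* z) refl
  distribˡ : ∀ x y z → x * (y - z) ≡ x * y - x * z
  distribˡ = solve 3 (λ x y z → x :* (y :- z) := x :* y :- x :* z) refl

altBinom-cong : ∀ r {a b : ℕ → ℚ} → (∀ i → a i ≡ b i) → altBinom r a ≡ altBinom r b
altBinom-cong r a≡b = Σ-cong (suc r) (λ i → cong (altCoeff r i *_) (a≡b i))

altBinom-Σ : ∀ r N (A : ℕ → ℕ → ℚ) (F : ℕ → ℚ) →
  altBinom r (λ i → Σℚ< N (λ l → A i l * F l)) ≡ Σℚ< N (λ l → altBinom r (λ i → A i l) * F l)
altBinom-Σ r N A F = begin
  Σℚ< (suc r) (λ i → altCoeff r i * Σℚ< N (λ l → A i l * F l))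
    ≡⟨ Σ-cong (suc r) (λ i → trans (*-distribˡ-Σ N (altCoeff r i) (λ l → A i l * F l))
                                   (Σ-cong N (λ l → sym (ℚP.*-assoc (altCoeff r i) (A i l) (F l))))) ⟩
  Σℚ< (suc r) (λ i → Σℚ< N (λ l → altCoeff r i * A i l * F l))
    ≡⟨ Σ-comm (suc r) N (λ i l → altCoeff r i * A i l * F l) ⟩
  Σℚ< N (λ l → Σℚ< (suc r) (λ i → altCoeff r i * A i l * F l))
    ≡⟨ Σ-cong N (λ l → sym (*-distribʳ-Σ (suc r) (F l) (λ i → altCoeff r i * A i l))) ⟩
  Σℚ< N (λ l → altBinom r (λ i → A i l) * F l) ∎
  where open ≡-Reasoning

Σ-pascal : ∀ j N (f : ℕ → ℚ) →
  Σℚ< (suc N) (λ l → ℕ→ℚ (suc j C l) * f l)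
    ≡ Σℚ< (suc N) (λ l → ℕ→ℚ (j C l) * f l) + Σℚ< N (λ l → ℕ→ℚ (j C l) * f (suc l))
Σ-pascal j N f = begin
  Σℚ< (suc N) (λ l → ℕ→ℚ (suc j C l) * f l)
    ≡⟨ Σ-suc N (λ l → ℕ→ℚ (suc j C l) * f l) ⟩
  ℕ→ℚ 1 * f 0 + Σℚ< N (λ l → ℕ→ℚ (suc j C suc l) * f (suc l))
    ≡⟨ cong (λ x → ℕ→ℚ 1 * f 0 + x) (trans (Σ-cong N split) (Σ-distrib-+ N _ _)) ⟩
  ℕ→ℚ 1 * f 0 + (Σℚ< N (λ l → ℕ→ℚ (j C suc l) * f (suc l)) + Σℚ< N (λ l → ℕ→ℚ (j C l) * f (suc l)))
    ≡⟨ sym (ℚP.+-assoc (ℕ→ℚ 1 * f 0) _ _) ⟩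
  (ℕ→ℚ 1 * f 0 + Σℚ< N (λ l → ℕ→ℚ (j C suc l) * f (suc l))) + Σℚ< N (λ l → ℕ→ℚ (j C l) * f (suc l))
    ≡⟨ cong (_+ Σℚ< N (λ l → ℕ→ℚ (j C l) * f (suc l))) (sym (Σ-suc N (λ l → ℕ→ℚ (j C l) * f l))) ⟩
  Σℚ< (suc N) (λ l → ℕ→ℚ (j C l) * f l) + Σℚ< N (λ l → ℕ→ℚ (j C l) * f (suc l)) ∎
  where
  open ≡-Reasoning
  split : ∀ l → ℕ→ℚ (suc j C suc l) * f (suc l) ≡ ℕ→ℚ (j C suc l) * f (suc l) + ℕ→ℚ (j C l) * f (suc l)
  split l = begin
    ℕ→ℚ (suc j C suc l) * f (suc l)
      ≡⟨ cong (λ m → ℕ→ℚ m * f (suc l)) (trans (sym (nCk+nC[k+1]≡[n+1]C[k+1] j l)) (ℕP.+-comm (j C l) (j C suc l))) ⟩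
    ℕ→ℚ ((j C suc l) ℕ.+ (j C l)) * f (suc l)
      ≡⟨ cong (_* f (suc l)) (ℕ→ℚ-+ (j C suc l) (j C l)) ⟩
    (ℕ→ℚ (j C suc l) + ℕ→ℚ (j C l)) * f (suc l)
      ≡⟨ ℚP.*-distribʳ-+ (f (suc l)) (ℕ→ℚ (j C suc l)) (ℕ→ℚ (j C l)) ⟩
    ℕ→ℚ (j C suc l) * f (suc l) + ℕ→ℚ (j C l) * f (suc l) ∎

Σ-C-zero : ∀ L (f : ℕ → ℚ) → (∀ l → L ℕ.≤ l → f l ≡ 0ℚ) → Σℚ< L (λ l → ℕ→ℚ (0 C l) * f l) ≡ f 0
Σ-C-zero zero    f f≡0 = sym (f≡0 0 z≤n)
Σ-C-zero (suc L) f _   = begin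
  Σℚ< (suc L) (λ l → ℕ→ℚ (0 C l) * f l)       ≡⟨ Σ-suc L (λ l → ℕ→ℚ (0 C l) * f l) ⟩
  1ℚ * f 0 + Σℚ< L (λ l → 0ℚ * f (suc l))      ≡⟨ cong₂ _+_ (ℚP.*-identityˡ (f 0)) (Σ-vanish L (λ l _ → ℚP.*-zeroˡ (f (suc l)))) ⟩
  f 0 + 0ℚ                                     ≡⟨ ℚP.+-identityʳ (f 0) ⟩
  f 0                                          ∎
  where open ≡-Reasoning

Σ-C-suc : ∀ j L (f : ℕ → ℚ) → (∀ l → L ℕ.≤ l → f l ≡ 0ℚ) →
  Σℚ< L (λ l → ℕ→ℚ (suc j C l) * f l)
    ≡ Σℚ< L (λ l → ℕ→ℚ (j C l) * f l) + Σℚ< L (λ l → ℕ→ℚ (j C l) * f (suc l))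
Σ-C-suc j zero    f _   = refl
Σ-C-suc j (suc L) f f≡0 = trans (Σ-pascal j L f) (cong (λ x → Σℚ< (suc L) (λ l → ℕ→ℚ (j C l) * f l) + x) (sym drop-last))
  where
  drop-last : Σℚ< (suc L) (λ l → ℕ→ℚ (j C l) * f (suc l)) ≡ Σℚ< L (λ l → ℕ→ℚ (j C l) * f (suc l))
  drop-last = trans (cong (λ x → Σℚ< L (λ l → ℕ→ℚ (j C l) * f (suc l)) + ℕ→ℚ (j C L) * x) (f≡0 (suc L) ℕP.≤-refl))
                    (trans (cong (λ x → Σℚ< L (λ l → ℕ→ℚ (j C l) * f (suc l)) + x) (ℚP.*-zeroʳ (ℕ→ℚ (j C L))))
                           (ℚP.+-identityʳ _))

module PascalArray (N : ℕ) (U : ℕ → ℕ → ℚ)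
                   (U-pascal : ∀ s k → U (suc s) k ≡ U s k + U s (suc k))
                   (U-vanish : ∀ s k → N ℕ.≤ k → U s k ≡ 0ℚ) where

  private
    U-vanish-shifted : ∀ s k l → N ℕ.≤ l → U s (k ℕ.+ l) ≡ 0ℚ
    U-vanish-shifted s k l N≤l = U-vanish s (k ℕ.+ l) (ℕP.≤-trans N≤l (ℕP.m≤n+m l k))

  U-binomial : ∀ j s k → U (s ℕ.+ j) k ≡ Σℚ< N (λ l → ℕ→ℚ (j C l) * U s (k ℕ.+ l))
  U-binomial zero    s k = begin
    U (s ℕ.+ 0) k  ≡⟨ cong₂ U (ℕP.+-identityʳ s) (sym (ℕP.+-identityʳ k)) ⟩
    U s (k ℕ.+ 0)  ≡⟨ sym (Σ-C-zero N (λ l → U s (k ℕ.+ l)) (U-vanish-shifted s k)) ⟩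
    Σℚ< N (λ l → ℕ→ℚ (0 C l) * U s (k ℕ.+ l)) ∎
    where open ≡-Reasoning
  U-binomial (suc j) s k = begin
    U (s ℕ.+ suc j) k
      ≡⟨ cong (λ x → U x k) (ℕP.+-suc s j) ⟩
    U (suc (s ℕ.+ j)) k
      ≡⟨ U-pascal (s ℕ.+ j) k ⟩
    U (s ℕ.+ j) k + U (s ℕ.+ j) (suc k)
      ≡⟨ cong₂ _+_ (U-binomial j s k) (U-binomial j s (suc k)) ⟩
    Σℚ< N (λ l → ℕ→ℚ (j C l) * U s (k ℕ.+ l)) + Σℚ< N (λ l → ℕ→ℚ (j C l) * U s (suc k ℕ.+ l))
      ≡⟨ cong (λ x → Σℚ< N (λ l → ℕ→ℚ (j C l) * U s (k ℕ.+ l)) + x)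
              (Σ-cong N (λ l → cong (λ x → ℕ→ℚ (j C l) * U s x) (sym (ℕP.+-suc k l)))) ⟩
    Σℚ< N (λ l → ℕ→ℚ (j C l) * U s (k ℕ.+ l)) + Σℚ< N (λ l → ℕ→ℚ (j C l) * U s (k ℕ.+ suc l))
      ≡⟨ sym (Σ-C-suc j N (λ l → U s (k ℕ.+ l)) (U-vanish-shifted s k)) ⟩
    Σℚ< N (λ l → ℕ→ℚ (suc j C l) * U s (k ℕ.+ l)) ∎
    where open ≡-Reasoning

  altBinom-U : ∀ r m → altBinom r (λ i → U i m) ≡ U 0 (m ℕ.+ r)
  altBinom-U zero    m = trans (altBinom-zero (λ i → U i m)) (cong (U 0) (sym (ℕP.+-identityʳ m)))
  altBinom-U (suc r) m = begin
    altBinom (suc r) (λ i → U i m)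
      ≡⟨ altBinom-suc r (λ i → U i m) ⟩
    altBinom r (λ i → U (suc i) m - U i m)
      ≡⟨ altBinom-cong r (λ i → trans (cong (_- U i m) (U-pascal i m))
                                      (solve 2 (λ x y → (x :+ y) :- x := y) refl (U i m) (U i (suc m)))) ⟩
    altBinom r (λ i → U i (suc m))
      ≡⟨ altBinom-U r (suc m) ⟩
    U 0 (suc m ℕ.+ r)
      ≡⟨ cong (U 0) (sym (ℕP.+-suc m r)) ⟩
    U 0 (m ℕ.+ suc r) ∎
    where open ≡-Reasoning

-- Binomial sums against (-1)^j / j! and 1 / 2^(j+1)

signedInv! : ℕ → ℚ
signedInv! j = ℤ→ℚ (sgn j) * inv! j

sgn-+ : ∀ a b → sgn (a ℕ.+ b) ≡ sgn a ℤ.* sgn b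
sgn-+ zero    b = sym (ℤP.*-identityˡ (sgn b))
sgn-+ (suc a) b = trans (cong ℤ.-_ (sgn-+ a b)) (ℤP.neg-distribˡ-* (sgn a) (sgn b))

inv!-* : ∀ l d → inv! l * inv! d ≡ inv! (l ℕ.+ d) * ℕ→ℚ ((l ℕ.+ d) C l)
inv!-* l d = ℕ→ℚ-*-cancelˡ ((l ℕ.+ d) !) {{(l ℕ.+ d) ℕP.!≢0}} _ _ (trans lhs (sym rhs))
  where
  C′ = (l ℕ.+ d) C l
  lhs : ℕ→ℚ ((l ℕ.+ d) !) * (inv! l * inv! d) ≡ ℕ→ℚ C′
  lhs = begin
    ℕ→ℚ ((l ℕ.+ d) !) * (inv! l * inv! d)
      ≡⟨ cong (λ m → ℕ→ℚ m * (inv! l * inv! d)) (sym ([m+n]Cm*m!*n!≡[m+n]! l d)) ⟩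
    ℕ→ℚ (C′ ℕ.* (l ! ℕ.* d !)) * (inv! l * inv! d)
      ≡⟨ cong (_* (inv! l * inv! d)) (trans (ℕ→ℚ-* C′ _) (cong (ℕ→ℚ C′ *_) (ℕ→ℚ-* (l !) (d !)))) ⟩
    ℕ→ℚ C′ * (ℕ→ℚ (l !) * ℕ→ℚ (d !)) * (inv! l * inv! d)
      ≡⟨ solve 5 (λ c a ia b ib → c :* (a :* b) :* (ia :* ib) := c :* (a :* ia) :* (b :* ib)) refl
           (ℕ→ℚ C′) (ℕ→ℚ (l !)) (inv! l) (ℕ→ℚ (d !)) (inv! d) ⟩
    ℕ→ℚ C′ * (ℕ→ℚ (l !) * inv! l) * (ℕ→ℚ (d !) * inv! d)
      ≡⟨ cong₂ (λ x y → ℕ→ℚ C′ * x * y) (ℕ→ℚ*inv!≡1 l) (ℕ→ℚ*inv!≡1 d) ⟩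
    ℕ→ℚ C′ * 1ℚ * 1ℚ
      ≡⟨ solve 1 (λ x → x :* con 1ℚ :* con 1ℚ := x) refl (ℕ→ℚ C′) ⟩
    ℕ→ℚ C′ ∎
    where open ≡-Reasoning
  rhs : ℕ→ℚ ((l ℕ.+ d) !) * (inv! (l ℕ.+ d) * ℕ→ℚ C′) ≡ ℕ→ℚ C′
  rhs = trans (sym (ℚP.*-assoc (ℕ→ℚ ((l ℕ.+ d) !)) (inv! (l ℕ.+ d)) (ℕ→ℚ C′)))
              (trans (cong (_* ℕ→ℚ C′) (ℕ→ℚ*inv!≡1 (l ℕ.+ d))) (ℚP.*-identityˡ _))

signedInv!-* : ∀ l d → signedInv! l * signedInv! d ≡ signedInv! (l ℕ.+ d) * ℕ→ℚ ((l ℕ.+ d) C l)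
signedInv!-* l d = begin
  ℤ→ℚ (sgn l) * inv! l * (ℤ→ℚ (sgn d) * inv! d)
    ≡⟨ solve 4 (λ a b c d → (a :* b) :* (c :* d) := (a :* c) :* (b :* d)) refl (ℤ→ℚ (sgn l)) (inv! l) (ℤ→ℚ (sgn d)) (inv! d) ⟩
  ℤ→ℚ (sgn l) * ℤ→ℚ (sgn d) * (inv! l * inv! d)
    ≡⟨ cong₂ _*_ (sym (trans (cong ℤ→ℚ (sgn-+ l d)) (ℤ→ℚ-* (sgn l) (sgn d)))) (inv!-* l d) ⟩
  ℤ→ℚ (sgn (l ℕ.+ d)) * (inv! (l ℕ.+ d) * ℕ→ℚ ((l ℕ.+ d) C l))
    ≡⟨ sym (ℚP.*-assoc (ℤ→ℚ (sgn (l ℕ.+ d))) (inv! (l ℕ.+ d)) (ℕ→ℚ ((l ℕ.+ d) C l))) ⟩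
  signedInv! (l ℕ.+ d) * ℕ→ℚ ((l ℕ.+ d) C l) ∎
  where open ≡-Reasoning

Σ-signedInv!-C : ∀ M l → Σℚ< M (λ j → signedInv! j * ℕ→ℚ (j C l)) ≡ signedInv! l * eInvPartial (M ℕ.∸ l)
Σ-signedInv!-C zero    l = trans (sym (ℚP.*-zeroʳ (signedInv! l))) (cong (λ m → signedInv! l * eInvPartial m) (sym (ℕP.0∸n≡0 l)))
Σ-signedInv!-C (suc M) l with l ℕP.≤? M
... | yes l≤M = begin
  Σℚ< M (λ j → signedInv! j * ℕ→ℚ (j C l)) + signedInv! M * ℕ→ℚ (M C l)
    ≡⟨ cong₂ _+_ (Σ-signedInv!-C M l) (cong (λ m → signedInv! m * ℕ→ℚ (m C l)) (sym (ℕP.m+[n∸m]≡n l≤M))) ⟩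
  signedInv! l * eInvPartial (M ℕ.∸ l) + signedInv! (l ℕ.+ (M ℕ.∸ l)) * ℕ→ℚ ((l ℕ.+ (M ℕ.∸ l)) C l)
    ≡⟨ cong (λ x → signedInv! l * eInvPartial (M ℕ.∸ l) + x) (sym (signedInv!-* l (M ℕ.∸ l))) ⟩
  signedInv! l * eInvPartial (M ℕ.∸ l) + signedInv! l * signedInv! (M ℕ.∸ l)
    ≡⟨ sym (ℚP.*-distribˡ-+ (signedInv! l) _ _) ⟩
  signedInv! l * eInvPartial (suc (M ℕ.∸ l))
    ≡⟨ cong (λ m → signedInv! l * eInvPartial m) (sym (ℕP.+-∸-assoc 1 l≤M)) ⟩
  signedInv! l * eInvPartial (suc M ℕ.∸ l) ∎
  where open ≡-Reasoning
... | no l≰M = begin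
  Σℚ< M (λ j → signedInv! j * ℕ→ℚ (j C l)) + signedInv! M * ℕ→ℚ (M C l)
    ≡⟨ cong₂ _+_ (Σ-signedInv!-C M l) (cong (λ m → signedInv! M * ℕ→ℚ m) (k>n⇒nCk≡0 (ℕP.≰⇒> l≰M))) ⟩
  signedInv! l * eInvPartial (M ℕ.∸ l) + signedInv! M * 0ℚ
    ≡⟨ trans (cong (λ x → signedInv! l * eInvPartial (M ℕ.∸ l) + x) (ℚP.*-zeroʳ (signedInv! M))) (ℚP.+-identityʳ _) ⟩
  signedInv! l * eInvPartial (M ℕ.∸ l)
    ≡⟨ cong (λ m → signedInv! l * eInvPartial m)
            (trans (ℕP.m≤n⇒m∸n≡0 (ℕP.<⇒≤ (ℕP.≰⇒> l≰M))) (sym (ℕP.m≤n⇒m∸n≡0 (ℕP.≰⇒> l≰M)))) ⟩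
  signedInv! l * eInvPartial (suc M ℕ.∸ l) ∎
  where open ≡-Reasoning

inv2^-suc : ∀ k → inv2^ k ≡ ℕ→ℚ 2 * inv2^ (suc k)
inv2^-suc k = ℕ→ℚ-*-cancelˡ (2 ℕ.^ suc k) {{2^≢0 (suc k)}} _ _ (trans lhs (sym rhs))
  where
  lhs : ℕ→ℚ (2 ℕ.^ suc k) * inv2^ k ≡ ℕ→ℚ 2
  lhs = begin
    ℕ→ℚ (2 ℕ.* 2 ℕ.^ k) * inv2^ k     ≡⟨ cong (_* inv2^ k) (ℕ→ℚ-* 2 (2 ℕ.^ k)) ⟩
    ℕ→ℚ 2 * ℕ→ℚ (2 ℕ.^ k) * inv2^ k   ≡⟨ ℚP.*-assoc (ℕ→ℚ 2) (ℕ→ℚ (2 ℕ.^ k)) (inv2^ k) ⟩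
    ℕ→ℚ 2 * (ℕ→ℚ (2 ℕ.^ k) * inv2^ k) ≡⟨ cong (ℕ→ℚ 2 *_) (ℕ→ℚ*inv2^≡1 k) ⟩
    ℕ→ℚ 2 * 1ℚ                        ≡⟨ ℚP.*-identityʳ _ ⟩
    ℕ→ℚ 2                             ∎
    where open ≡-Reasoning
  rhs : ℕ→ℚ (2 ℕ.^ suc k) * (ℕ→ℚ 2 * inv2^ (suc k)) ≡ ℕ→ℚ 2
  rhs = begin
    ℕ→ℚ (2 ℕ.^ suc k) * (ℕ→ℚ 2 * inv2^ (suc k))
      ≡⟨ solve 3 (λ a b c → a :* (b :* c) := b :* (a :* c)) refl (ℕ→ℚ (2 ℕ.^ suc k)) (ℕ→ℚ 2) (inv2^ (suc k)) ⟩
    ℕ→ℚ 2 * (ℕ→ℚ (2 ℕ.^ suc k) * inv2^ (suc k))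
      ≡⟨ cong (ℕ→ℚ 2 *_) (ℕ→ℚ*inv2^≡1 (suc k)) ⟩
    ℕ→ℚ 2 * 1ℚ
      ≡⟨ ℚP.*-identityʳ _ ⟩
    ℕ→ℚ 2 ∎
    where open ≡-Reasoning

binomPrefix : ℕ → ℕ → ℕ
binomPrefix M l = Σℕ< (suc l) (λ t → M C t)

binomPrefix-zero : ∀ l → binomPrefix 0 l ≡ 1
binomPrefix-zero zero    = refl
binomPrefix-zero (suc l) = trans (ℕP.+-identityʳ (binomPrefix 0 l)) (binomPrefix-zero l)

binomPrefix-suc : ∀ M l → binomPrefix (suc M) l ℕ.+ M C l ≡ 2 ℕ.* binomPrefix M l
binomPrefix-suc M zero    = refl
binomPrefix-suc M (suc l) rewrite sym (nCk+nC[k+1]≡[n+1]C[k+1] M l) = begin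
  binomPrefix (suc M) l ℕ.+ (M C l ℕ.+ M C suc l) ℕ.+ M C suc l
    ≡⟨ regroup (binomPrefix (suc M) l) (M C l) (M C suc l) ⟩
  (binomPrefix (suc M) l ℕ.+ M C l) ℕ.+ 2 ℕ.* (M C suc l)
    ≡⟨ cong (ℕ._+ 2 ℕ.* (M C suc l)) (binomPrefix-suc M l) ⟩
  2 ℕ.* binomPrefix M l ℕ.+ 2 ℕ.* (M C suc l)
    ≡⟨ sym (ℕP.*-distribˡ-+ 2 (binomPrefix M l) (M C suc l)) ⟩
  2 ℕ.* binomPrefix M (suc l) ∎
  where
  open ≡-Reasoning
  regroup : ∀ a c d → a ℕ.+ (c ℕ.+ d) ℕ.+ d ≡ (a ℕ.+ c) ℕ.+ 2 ℕ.* d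
  regroup = solve-∀

Σ-C-inv2^ : ∀ M l → Σℚ< M (λ j → ℕ→ℚ (j C l) * inv2^ (suc j)) ≡ 1ℚ - ℕ→ℚ (binomPrefix M l) * inv2^ M
Σ-C-inv2^ zero    l rewrite binomPrefix-zero l = refl
Σ-C-inv2^ (suc M) l = begin
  Σℚ< M (λ j → ℕ→ℚ (j C l) * inv2^ (suc j)) + ℕ→ℚ (M C l) * h
    ≡⟨ cong (_+ ℕ→ℚ (M C l) * h) (Σ-C-inv2^ M l) ⟩
  1ℚ - ℕ→ℚ (binomPrefix M l) * inv2^ M + ℕ→ℚ (M C l) * h
    ≡⟨ cong (λ x → 1ℚ - ℕ→ℚ (binomPrefix M l) * x + ℕ→ℚ (M C l) * h) (inv2^-suc M) ⟩
  1ℚ - ℕ→ℚ (binomPrefix M l) * (ℕ→ℚ 2 * h) + ℕ→ℚ (M C l) * h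
    ≡⟨ solve 4 (λ b two c h → con 1ℚ :- b :* (two :* h) :+ c :* h := con 1ℚ :- ((two :* b) :- c) :* h) refl
         (ℕ→ℚ (binomPrefix M l)) (ℕ→ℚ 2) (ℕ→ℚ (M C l)) h ⟩
  1ℚ - (ℕ→ℚ 2 * ℕ→ℚ (binomPrefix M l) - ℕ→ℚ (M C l)) * h
    ≡⟨ cong (λ x → 1ℚ - (x - ℕ→ℚ (M C l)) * h)
            (trans (sym (ℕ→ℚ-* 2 (binomPrefix M l)))
                   (trans (cong ℕ→ℚ (sym (binomPrefix-suc M l))) (ℕ→ℚ-+ (binomPrefix (suc M) l) (M C l)))) ⟩
  1ℚ - (ℕ→ℚ (binomPrefix (suc M) l) + ℕ→ℚ (M C l) - ℕ→ℚ (M C l)) * h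
    ≡⟨ solve 3 (λ b c h → con 1ℚ :- (b :+ c :- c) :* h := con 1ℚ :- b :* h) refl (ℕ→ℚ (binomPrefix (suc M) l)) (ℕ→ℚ (M C l)) h ⟩
  1ℚ - ℕ→ℚ (binomPrefix (suc M) l) * h ∎
  where
  open ≡-Reasoning
  h = inv2^ (suc M)

-- Null and Cauchy sequences

-- Small q x says ∣ x ∣ ≤ 1 / (q + 1) without division. Small, Null and Cauchy are records
-- rather than synonyms so that their indices can be inferred.
record Small (q : ℕ) (x : ℚ) : Set where
  constructor small
  field ∣x∣*[1+q]≤1 : ∣ x ∣ * ℕ→ℚ (suc q) ℚ.≤ 1ℚ

record Null (a : ℕ → ℚ) : Set where
  constructor null
  field eventually-small : ∀ q → ∃[ N ] (∀ m → N ℕ.≤ m → Small q (a m))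

record Cauchy (a : ℕ → ℚ) : Set where
  constructor cauchy
  field eventually-close : ∀ q → ∃[ N ] (∀ m k → N ℕ.≤ m → N ℕ.≤ k → Small q (a m - a k))

-- Small (twice q) halves the tolerance of Small q, as 1 + twice q = 2 (1 + q).
twice : ℕ → ℕ
twice q = q ℕ.+ suc q

small-cong : ∀ {q x y} → x ≡ y → Small q x → Small q y
small-cong refl s = s

small-0 : ∀ q → Small q 0ℚ
small-0 q = small (ℚP.≤-trans (ℚP.≤-reflexive (ℚP.*-zeroˡ (ℕ→ℚ (suc q)))) (ℚ.*≤* (ℤ.+≤+ z≤n)))

small-neg : ∀ {q} x → Small q x → Small q (- x)
small-neg {q} x (small s) = small (subst (λ z → z * ℕ→ℚ (suc q) ℚ.≤ 1ℚ) (sym (ℚP.∣-p∣≡∣p∣ x)) s)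

small-+ : ∀ {q} x y → Small (twice q) x → Small (twice q) y → Small q (x + y)
small-+ {q} x y (small sx) (small sy) = small (ℚP.*-cancelˡ-≤-pos (ℕ→ℚ 2) {{ℕ→ℚ-pos 2}} (begin
  ℕ→ℚ 2 * (∣ x + y ∣ * Q)         ≤⟨ ℚP.*-monoˡ-≤-nonNeg (ℕ→ℚ 2) {{ℕ→ℚ-nonNeg 2}}
                                        (ℚP.*-monoʳ-≤-nonNeg Q {{ℕ→ℚ-nonNeg (suc q)}} (ℚP.∣p+q∣≤∣p∣+∣q∣ x y)) ⟩
  ℕ→ℚ 2 * ((∣ x ∣ + ∣ y ∣) * Q)   ≡⟨ solve 3 (λ a b Q → con (ℕ→ℚ 2) :* ((a :+ b) :* Q) := a :* (Q :+ Q) :+ b :* (Q :+ Q)) refl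
                                        ∣ x ∣ ∣ y ∣ Q ⟩
  ∣ x ∣ * (Q + Q) + ∣ y ∣ * (Q + Q) ≡⟨ cong (λ z → ∣ x ∣ * z + ∣ y ∣ * z) (sym (ℕ→ℚ-+ (suc q) (suc q))) ⟩
  ∣ x ∣ * ℕ→ℚ (suc (twice q)) + ∣ y ∣ * ℕ→ℚ (suc (twice q)) ≤⟨ ℚP.+-mono-≤ sx sy ⟩
  ℕ→ℚ 2 * 1ℚ                      ∎))
  where
  open ℚP.≤-Reasoning
  Q = ℕ→ℚ (suc q)

small-- : ∀ {q} x y → Small (twice q) x → Small (twice q) y → Small q (x - y)
small-- x y sx sy = small-+ x (- y) sx (small-neg y sy)

∣p∣≤∣↥p∣ : ∀ p → ∣ p ∣ ℚ.≤ ℕ→ℚ ℤ.∣ ℚ.↥ p ∣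
∣p∣≤∣↥p∣ (mkℚ z d c) = subst (mkℚ (+ ℤ.∣ z ∣) d c ℚ.≤_) (sym (ℤ→ℚ≡mkℚ (+ ℤ.∣ z ∣))) (ℚ.*≤*
  (subst₂ ℤ._≤_ (ℤP.pos-* ℤ.∣ z ∣ 1) (ℤP.pos-* ℤ.∣ z ∣ (suc d)) (ℤ.+≤+ (ℕP.*-monoʳ-≤ ℤ.∣ z ∣ (s≤s z≤n)))))

-- The scale factor makes up for ∣ c ∣ ≤ ∣ numerator of c ∣.
small-* : ∀ {q} c x → Small (ℤ.∣ ℚ.↥ c ∣ ℕ.* suc q) x → Small q (c * x)
small-* {q} c x (small s) = small (begin
  ∣ c * x ∣ * Q               ≡⟨ cong (_* Q) (ℚP.∣p*q∣≡∣p∣*∣q∣ c x) ⟩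
  ∣ c ∣ * ∣ x ∣ * Q           ≤⟨ ℚP.*-monoʳ-≤-nonNeg Q {{ℕ→ℚ-nonNeg (suc q)}}
                                   (ℚP.*-monoʳ-≤-nonNeg ∣ x ∣ {{ℚP.∣-∣-nonNeg x}} (∣p∣≤∣↥p∣ c)) ⟩
  ℕ→ℚ K * ∣ x ∣ * Q           ≡⟨ solve 3 (λ a b c → a :* b :* c := b :* (a :* c)) refl (ℕ→ℚ K) ∣ x ∣ Q ⟩
  ∣ x ∣ * (ℕ→ℚ K * Q)         ≡⟨ cong (∣ x ∣ *_) (sym (ℕ→ℚ-* K (suc q))) ⟩
  ∣ x ∣ * ℕ→ℚ (K ℕ.* suc q)   ≤⟨ ℚP.*-monoˡ-≤-nonNeg ∣ x ∣ {{ℚP.∣-∣-nonNeg x}} (ℕ→ℚ-mono-≤ (ℕP.n≤1+n (K ℕ.* suc q))) ⟩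
  ∣ x ∣ * ℕ→ℚ (suc (K ℕ.* suc q)) ≤⟨ s ⟩
  1ℚ                          ∎)
  where
  open ℚP.≤-Reasoning
  K = ℤ.∣ ℚ.↥ c ∣
  Q = ℕ→ℚ (suc q)

archimedean : ∀ ε → 0ℚ ℚ.< ε → ∃[ q ] (1ℚ ℚ.< ε * ℕ→ℚ (suc q))
archimedean (mkℚ +[1+ a ] d c) _ = twice d , (begin-strict
  1ℚ                                  <⟨ ℚ.*<* (ℤ.+<+ (s≤s (s≤s z≤n))) ⟩
  ℕ→ℚ 2                               ≡⟨ sym (cong (λ x → x + x) (trans (ℚP.*-comm (inv (suc d)) (ℕ→ℚ (suc d))) (ℕ→ℚ*inv≡1 (suc d)))) ⟩
  inv (suc d) * ℕ→ℚ (suc d) + inv (suc d) * ℕ→ℚ (suc d)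
                                      ≡⟨ sym (trans (cong (inv (suc d) *_) (ℕ→ℚ-+ (suc d) (suc d))) (ℚP.*-distribˡ-+ (inv (suc d)) _ _)) ⟩
  inv (suc d) * ℕ→ℚ (suc (twice d))   ≤⟨ ℚP.*-monoʳ-≤-nonNeg (ℕ→ℚ (suc (twice d))) {{ℕ→ℚ-nonNeg (suc (twice d))}} 1/[1+d]≤ε ⟩
  ε * ℕ→ℚ (suc (twice d))             ∎)
  where
  open ℚP.≤-Reasoning
  ε = mkℚ +[1+ a ] d c
  1/[1+d]≤ε : inv (suc d) ℚ.≤ ε
  1/[1+d]≤ε = subst (ℚ._≤ ε) (sym (ℚP.↥p/↧p≡p (mkℚ (+ 1) d (1-coprimeTo _))))
    (ℚ.*≤* (subst₂ ℤ._≤_ (ℤP.pos-* 1 (suc d)) (ℤP.pos-* (suc a) (suc d)) (ℤ.+≤+ (ℕP.*-monoˡ-≤ (suc d) (s≤s (z≤n {a}))))))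
archimedean (mkℚ (+ 0)    d c) (ℚ.*<* p) with () ← ℤP.<-irrefl refl p
archimedean (mkℚ -[1+ a ] d c) (ℚ.*<* ())

small⇒<ε : ∀ {q} ε x → 1ℚ ℚ.< ε * ℕ→ℚ (suc q) → Small q x → ∣ x ∣ ℚ.< ε
small⇒<ε {q} ε x 1<ε[1+q] (small s) = ℚP.*-cancelʳ-<-nonNeg (ℕ→ℚ (suc q)) {{ℕ→ℚ-nonNeg (suc q)}} (ℚP.≤-<-trans s 1<ε[1+q])

null⇒convergesTo : ∀ a L → Null (λ m → a m - L) → ConvergesTo a L
null⇒convergesTo a L (null ev) ε ε>0 with archimedean ε ε>0
... | q , 1<ε[1+q] with ev q
... | N , sm = N , λ m N≤m → small⇒<ε ε (a m - L) 1<ε[1+q] (sm m N≤m)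

cauchy⇒isCauchy : ∀ a → Cauchy a → IsCauchy a
cauchy⇒isCauchy a (cauchy ev) ε ε>0 with archimedean ε ε>0
... | q , 1<ε[1+q] with ev q
... | N , sm = N , λ m k N≤m N≤k → small⇒<ε ε (a m - a k) 1<ε[1+q] (sm m k N≤m N≤k)

convergesTo-cong : ∀ {a b L L′} → (∀ m → a m ≡ b m) → L ≡ L′ → ConvergesTo a L → ConvergesTo b L′
convergesTo-cong a≡b L≡L′ a→L ε ε>0 = let N , close = a→L ε ε>0 in
  N , λ m N≤m → subst (λ x → ∣ x ∣ ℚ.< ε) (cong₂ _-_ (a≡b m) L≡L′) (close m N≤m)

sameLimit-cong : ∀ {a a′ b b′} → (∀ m → a m ≡ a′ m) → (∀ m → b m ≡ b′ m) → SameLimit a b → SameLimit a′ b′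
sameLimit-cong a≡a′ b≡b′ = convergesTo-cong {L = 0ℚ} (λ m → cong₂ _-_ (a≡a′ m) (b≡b′ m)) refl

null-cong : ∀ {a b} → (∀ m → a m ≡ b m) → Null a → Null b
null-cong a≡b (null ev) = null λ q → let N , sm = ev q in N , λ m N≤m → small-cong (a≡b m) (sm m N≤m)

null⇒sameLimit : ∀ a b → Null (λ m → a m - b m) → SameLimit a b
null⇒sameLimit a b a-b→0 = null⇒convergesTo (λ m → a m - b m) 0ℚ (null-cong (λ m → sym (ℚP.+-identityʳ (a m - b m))) a-b→0)

null-eventually : ∀ {a b} N₀ → (∀ m → N₀ ℕ.≤ m → a m ≡ b m) → Null b → Null a
null-eventually N₀ a≡b (null ev) = null λ q → let N , sm = ev q in N₀ ℕ.⊔ N , λ m le →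
  small-cong (sym (a≡b m (ℕP.≤-trans (ℕP.m≤m⊔n N₀ N) le))) (sm m (ℕP.≤-trans (ℕP.m≤n⊔m N₀ N) le))

null-+ : ∀ {a b} → Null a → Null b → Null (λ m → a m + b m)
null-+ {a} {b} (null ev₁) (null ev₂) = null λ q → let N₁ , sm₁ = ev₁ (twice q); N₂ , sm₂ = ev₂ (twice q) in
  N₁ ℕ.⊔ N₂ , λ m le →
    small-+ (a m) (b m) (sm₁ m (ℕP.≤-trans (ℕP.m≤m⊔n N₁ N₂) le)) (sm₂ m (ℕP.≤-trans (ℕP.m≤n⊔m N₁ N₂) le))

null-neg : ∀ {a} → Null a → Null (λ m → - a m)
null-neg {a} (null ev) = null λ q → let N , sm = ev q in N , λ m N≤m → small-neg (a m) (sm m N≤m)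

null-* : ∀ {a} c → Null a → Null (λ m → c * a m)
null-* {a} c (null ev) = null λ q → let N , sm = ev (ℤ.∣ ℚ.↥ c ∣ ℕ.* suc q) in N , λ m N≤m → small-* c (a m) (sm m N≤m)

null-Σ : ∀ L (A : ℕ → ℕ → ℚ) → (∀ l → Null (A l)) → Null (λ m → Σℚ< L (λ l → A l m))
null-Σ zero    A A→0 = null λ q → 0 , λ _ _ → small-0 q
null-Σ (suc L) A A→0 = null-+ (null-Σ L A A→0) (A→0 L)

null-∘ : ∀ {a} (f : ℕ → ℕ) → (∀ N → ∃[ N′ ] (∀ m → N′ ℕ.≤ m → N ℕ.≤ f m)) → Null a → Null (λ m → a (f m))
null-∘ f f→∞ (null ev) = null λ q → let N , sm = ev q; N′ , N≤f = f→∞ N in N′ , λ m N′≤m → sm (f m) (N≤f m N′≤m)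

null⇒cauchy : ∀ {a} L → Null (λ m → a m - L) → Cauchy a
null⇒cauchy {a} L (null ev) = cauchy λ q → let N , sm = ev (twice q) in N , λ m k N≤m N≤k →
  small-cong (solve 3 (λ x y l → (x :- l) :- (y :- l) := x :- y) refl (a m) (a k) L)
             (small-- (a m - L) (a k - L) (sm m N≤m) (sm k N≤k))

cauchy-cong : ∀ {a b} → (∀ m → a m ≡ b m) → Cauchy a → Cauchy b
cauchy-cong a≡b (cauchy ev) = cauchy λ q → let N , sm = ev q in
  N , λ m k N≤m N≤k → small-cong (cong₂ _-_ (a≡b m) (a≡b k)) (sm m k N≤m N≤k)

cauchy-+ : ∀ {a b} → Cauchy a → Cauchy b → Cauchy (λ m → a m + b m)
cauchy-+ {a} {b} (cauchy ev₁) (cauchy ev₂) = cauchy λ q → let N₁ , sm₁ = ev₁ (twice q); N₂ , sm₂ = ev₂ (twice q) in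
  N₁ ℕ.⊔ N₂ , λ m k le₁ le₂ →
  small-cong (solve 4 (λ x y z w → (x :- y) :+ (z :- w) := (x :+ z) :- (y :+ w)) refl (a m) (a k) (b m) (b k))
    (small-+ (a m - a k) (b m - b k)
      (sm₁ m k (ℕP.≤-trans (ℕP.m≤m⊔n N₁ N₂) le₁) (ℕP.≤-trans (ℕP.m≤m⊔n N₁ N₂) le₂))
      (sm₂ m k (ℕP.≤-trans (ℕP.m≤n⊔m N₁ N₂) le₁) (ℕP.≤-trans (ℕP.m≤n⊔m N₁ N₂) le₂)))

cauchy-* : ∀ {a} c → Cauchy a → Cauchy (λ m → c * a m)
cauchy-* {a} c (cauchy ev) = cauchy λ q → let N , sm = ev (ℤ.∣ ℚ.↥ c ∣ ℕ.* suc q) in N , λ m k N≤m N≤k →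
  small-cong (solve 3 (λ c x y → c :* (x :- y) := c :* x :- c :* y) refl c (a m) (a k)) (small-* c (a m - a k) (sm m k N≤m N≤k))

cauchy-Σ : ∀ L (A : ℕ → ℕ → ℚ) → (∀ l → Cauchy (A l)) → Cauchy (λ m → Σℚ< L (λ l → A l m))
cauchy-Σ zero    A A-cauchy = cauchy λ q → 0 , λ _ _ _ _ → small-0 q
cauchy-Σ (suc L) A A-cauchy = cauchy-+ (cauchy-Σ L A A-cauchy) (A-cauchy L)

cauchy-∸ : ∀ {a} l → Cauchy a → Cauchy (λ m → a (m ℕ.∸ l))
cauchy-∸ l (cauchy ev) = cauchy λ q → let N , sm = ev q in
  N ℕ.+ l , λ m k le₁ le₂ → sm (m ℕ.∸ l) (k ℕ.∸ l) (shift N le₁) (shift N le₂)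
  where
  shift : ∀ {m} N → N ℕ.+ l ℕ.≤ m → N ℕ.≤ m ℕ.∸ l
  shift {m} N le = subst (ℕ._≤ m ℕ.∸ l) (ℕP.m+n∸n≡m N l) (ℕP.∸-monoˡ-≤ l le)

small-frac : ∀ {q} x a b .{{_ : ℕ.NonZero b}} → ∣ x ∣ ℚ.≤ ℕ→ℚ a * inv b → a ℕ.* suc q ℕ.≤ b → Small q x
small-frac {q} x a b ∣x∣≤a/b a[1+q]≤b = small (begin
  ∣ x ∣ * ℕ→ℚ (suc q)              ≤⟨ ℚP.*-monoʳ-≤-nonNeg (ℕ→ℚ (suc q)) {{ℕ→ℚ-nonNeg (suc q)}} ∣x∣≤a/b ⟩
  ℕ→ℚ a * inv b * ℕ→ℚ (suc q)      ≡⟨ solve 3 (λ a i q → a :* i :* q := a :* q :* i) refl (ℕ→ℚ a) (inv b) (ℕ→ℚ (suc q)) ⟩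
  ℕ→ℚ a * ℕ→ℚ (suc q) * inv b      ≡⟨ cong (_* inv b) (sym (ℕ→ℚ-* a (suc q))) ⟩
  ℕ→ℚ (a ℕ.* suc q) * inv b        ≤⟨ frac-mono-≤ (a ℕ.* suc q) b 1 1
                                        (subst₂ ℕ._≤_ (sym (ℕP.*-identityʳ _)) (sym (ℕP.+-identityʳ b)) a[1+q]≤b) ⟩
  1ℚ                               ∎)
  where open ℚP.≤-Reasoning

∣sgn∣ : ∀ j → ∣ ℤ→ℚ (sgn j) ∣ ≡ 1ℚ
∣sgn∣ zero    = refl
∣sgn∣ (suc j) = trans (cong ∣_∣ (ℤ→ℚ-neg (sgn j))) (trans (ℚP.∣-p∣≡∣p∣ (ℤ→ℚ (sgn j))) (∣sgn∣ j))

∣signedInv!∣ : ∀ j → ∣ signedInv! j ∣ ≡ inv! j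
∣signedInv!∣ j = trans (ℚP.∣p*q∣≡∣p∣*∣q∣ (ℤ→ℚ (sgn j)) (inv! j))
  (trans (cong₂ _*_ (∣sgn∣ j) (ℚP.0≤p⇒∣p∣≡p (ℚP.nonNegative⁻¹ (inv! j) {{inv-nonNeg (j !) {{j ℕP.!≢0}}}})))
         (ℚP.*-identityˡ (inv! j)))

null-signedInv! : Null signedInv!
null-signedInv! = null λ q → suc q , λ m 1+q≤m →
  small-frac (signedInv! m) 1 (m !) {{m ℕP.!≢0}}
    (ℚP.≤-reflexive (trans (∣signedInv!∣ m) (sym (ℚP.*-identityˡ (inv! m)))))
    (ℕP.≤-trans (ℕP.≤-reflexive (ℕP.*-identityˡ (suc q))) (ℕP.≤-trans 1+q≤m (n≤n! m)))

null-eInvPartial-∸ : ∀ l → Null (λ M → eInvPartial (M ℕ.∸ l) - eInvPartial M)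
null-eInvPartial-∸ l = null-eventually l tail-sum
  (null-neg (null-Σ l (λ i M → signedInv! (M ℕ.∸ l ℕ.+ i)) (λ i → null-∘ (λ M → M ℕ.∸ l ℕ.+ i) (→∞ i) null-signedInv!)))
  where
  →∞ : ∀ i N → ∃[ N′ ] (∀ M → N′ ℕ.≤ M → N ℕ.≤ M ℕ.∸ l ℕ.+ i)
  →∞ i N = N ℕ.+ l , λ M le →
    ℕP.≤-trans (subst (ℕ._≤ M ℕ.∸ l) (ℕP.m+n∸n≡m N l) (ℕP.∸-monoˡ-≤ l le)) (ℕP.m≤m+n (M ℕ.∸ l) i)
  tail-sum : ∀ M → l ℕ.≤ M → eInvPartial (M ℕ.∸ l) - eInvPartial M ≡ - Σℚ< l (λ i → signedInv! (M ℕ.∸ l ℕ.+ i))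
  tail-sum M l≤M = begin
    E (M ℕ.∸ l) - E M                   ≡⟨ cong (λ m → E (M ℕ.∸ l) - E m) (sym (ℕP.m∸n+n≡m l≤M)) ⟩
    E (M ℕ.∸ l) - E (M ℕ.∸ l ℕ.+ l)     ≡⟨ cong (λ x → E (M ℕ.∸ l) - x) (Σ-split (M ℕ.∸ l) l signedInv!) ⟩
    E (M ℕ.∸ l) - (E (M ℕ.∸ l) + T)     ≡⟨ solve 2 (λ a b → a :- (a :+ b) := :- b) refl (E (M ℕ.∸ l)) T ⟩
    - T                                 ∎
    where
    open ≡-Reasoning
    E = eInvPartial
    T = Σℚ< l (λ i → signedInv! (M ℕ.∸ l ℕ.+ i))

nCk*[1+q]≤2^n : ∀ q t M → t ℕ.+ suc t ℕ.* suc q ℕ.≤ M → (M C t) ℕ.* suc q ℕ.≤ 2 ℕ.^ M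
nCk*[1+q]≤2^n q t M le = ℕP.*-cancelʳ-≤ ((M C t) ℕ.* suc q) (2 ℕ.^ M) (suc t) (begin
  (M C t) ℕ.* suc q ℕ.* suc t   ≡⟨ ℕP.*-assoc (M C t) (suc q) (suc t) ⟩
  (M C t) ℕ.* (suc q ℕ.* suc t) ≤⟨ ℕP.*-monoʳ-≤ (M C t) [1+q][1+t]≤M∸t ⟩
  (M C t) ℕ.* (M ℕ.∸ t)         ≡⟨ nCk*[n∸k]≡nC[k+1]*[k+1] M t ⟩
  (M C suc t) ℕ.* suc t         ≤⟨ ℕP.*-monoˡ-≤ (suc t) (nCk≤2^n M (suc t)) ⟩
  2 ℕ.^ M ℕ.* suc t             ∎)
  where
  open ℕP.≤-Reasoning
  [1+q][1+t]≤M∸t : suc q ℕ.* suc t ℕ.≤ M ℕ.∸ t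
  [1+q][1+t]≤M∸t = subst (ℕ._≤ M ℕ.∸ t) (trans (ℕP.m+n∸m≡n t (suc t ℕ.* suc q)) (ℕP.*-comm (suc t) (suc q)))
                         (ℕP.∸-monoˡ-≤ t le)

inv2^-nonNeg : ∀ M → ℚ.NonNegative (inv2^ M)
inv2^-nonNeg M = inv-nonNeg (2 ℕ.^ M) {{2^≢0 M}}

null-C/2^ : ∀ t → Null (λ M → ℕ→ℚ (M C t) * inv2^ M)
null-C/2^ t = null λ q → t ℕ.+ suc t ℕ.* suc q , λ M le →
  small-frac (ℕ→ℚ (M C t) * inv2^ M) (M C t) (2 ℕ.^ M) {{2^≢0 M}}
    (ℚP.≤-reflexive (ℚP.0≤p⇒∣p∣≡p (ℚP.nonNegative⁻¹ _
      {{ℚP.nonNeg*nonNeg⇒nonNeg (ℕ→ℚ (M C t)) {{ℕ→ℚ-nonNeg (M C t)}} (inv2^ M) {{inv2^-nonNeg M}}}})))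
    (nCk*[1+q]≤2^n q t M le)

null-binomPrefix/2^ : ∀ l → Null (λ M → ℕ→ℚ (binomPrefix M l) * inv2^ M)
null-binomPrefix/2^ l = null-cong
  (λ M → sym (trans (cong (_* inv2^ M) (ℕ→ℚ-Σ (suc l) (M C_))) (*-distribʳ-Σ (suc l) (inv2^ M) (λ t → ℕ→ℚ (M C t)))))
  (null-Σ (suc l) (λ t M → ℕ→ℚ (M C t) * inv2^ M) null-C/2^)

Σ-inv2^ : ∀ a k → Σℚ< k (λ i → inv2^ (a ℕ.+ i)) + ℕ→ℚ 2 * inv2^ (a ℕ.+ k) ≡ ℕ→ℚ 2 * inv2^ a
Σ-inv2^ a zero    = trans (ℚP.+-identityˡ _) (cong (λ m → ℕ→ℚ 2 * inv2^ m) (ℕP.+-identityʳ a))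
Σ-inv2^ a (suc k) = begin
  S + inv2^ (a ℕ.+ k) + ℕ→ℚ 2 * inv2^ (a ℕ.+ suc k)
    ≡⟨ cong (λ m → S + inv2^ (a ℕ.+ k) + ℕ→ℚ 2 * inv2^ m) (ℕP.+-suc a k) ⟩
  S + inv2^ (a ℕ.+ k) + ℕ→ℚ 2 * inv2^ (suc (a ℕ.+ k))
    ≡⟨ cong (λ x → S + inv2^ (a ℕ.+ k) + x) (sym (inv2^-suc (a ℕ.+ k))) ⟩
  S + inv2^ (a ℕ.+ k) + inv2^ (a ℕ.+ k)
    ≡⟨ solve 2 (λ s x → s :+ x :+ x := s :+ con (ℕ→ℚ 2) :* x) refl S (inv2^ (a ℕ.+ k)) ⟩
  S + ℕ→ℚ 2 * inv2^ (a ℕ.+ k)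
    ≡⟨ Σ-inv2^ a k ⟩
  ℕ→ℚ 2 * inv2^ a ∎
  where
  open ≡-Reasoning
  S = Σℚ< k (λ i → inv2^ (a ℕ.+ i))

inv![1+n]≤inv2^n : ∀ n → inv! (suc n) ℚ.≤ inv2^ n
inv![1+n]≤inv2^n n = subst₂ ℚ._≤_ (ℚP.*-identityˡ (inv! (suc n))) (ℚP.*-identityˡ (inv2^ n))
  (frac-mono-≤ 1 ((suc n) !) 1 (2 ℕ.^ n) {{(suc n) ℕP.!≢0}} {{2^≢0 n}}
    (subst₂ ℕ._≤_ (sym (ℕP.*-identityˡ (2 ℕ.^ n))) (sym (ℕP.*-identityˡ ((suc n) !))) (2^n≤[1+n]! n)))

eInvPartial-tail : ∀ a k → ∣ eInvPartial (suc a ℕ.+ k) - eInvPartial (suc a) ∣ ℚ.≤ ℕ→ℚ 2 * inv2^ a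
eInvPartial-tail a k = begin
  ∣ E (suc a ℕ.+ k) - E (suc a) ∣
    ≡⟨ cong (λ x → ∣ x - E (suc a) ∣) (Σ-split (suc a) k signedInv!) ⟩
  ∣ E (suc a) + T - E (suc a) ∣
    ≡⟨ cong ∣_∣ (solve 2 (λ x s → x :+ s :- x := s) refl (E (suc a)) T) ⟩
  ∣ T ∣
    ≤⟨ ∣Σ∣≤Σ∣∣ k (λ i → signedInv! (suc a ℕ.+ i)) ⟩
  Σℚ< k (λ i → ∣ signedInv! (suc a ℕ.+ i) ∣)
    ≤⟨ Σ-mono-≤ k (λ i → ℚP.≤-trans (ℚP.≤-reflexive (∣signedInv!∣ (suc a ℕ.+ i))) (inv![1+n]≤inv2^n (a ℕ.+ i))) ⟩
  Σℚ< k (λ i → inv2^ (a ℕ.+ i))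
    ≡⟨ sym (ℚP.+-identityʳ _) ⟩
  Σℚ< k (λ i → inv2^ (a ℕ.+ i)) + 0ℚ
    ≤⟨ ℚP.+-monoʳ-≤ (Σℚ< k (λ i → inv2^ (a ℕ.+ i)))
         (ℚP.nonNegative⁻¹ _ {{ℚP.nonNeg*nonNeg⇒nonNeg (ℕ→ℚ 2) {{ℕ→ℚ-nonNeg 2}} (inv2^ (a ℕ.+ k)) {{inv2^-nonNeg (a ℕ.+ k)}}}}) ⟩
  Σℚ< k (λ i → inv2^ (a ℕ.+ i)) + ℕ→ℚ 2 * inv2^ (a ℕ.+ k)
    ≡⟨ Σ-inv2^ a k ⟩
  ℕ→ℚ 2 * inv2^ a ∎
  where
  open ℚP.≤-Reasoning
  E = eInvPartial
  T = Σℚ< k (λ i → signedInv! (suc a ℕ.+ i))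

cauchy-eInvPartial : Cauchy eInvPartial
cauchy-eInvPartial = cauchy λ q → suc (a q) , λ m k 1+a≤m 1+a≤k →
  small-cong (solve 3 (λ x y z → (x :- z) :- (y :- z) := x :- y) refl (E m) (E k) (E (suc (a q))))
    (small-- (E m - E (suc (a q))) (E k - E (suc (a q))) (close m 1+a≤m) (close k 1+a≤k))
  where
  E = eInvPartial
  -- Chosen so that 2 / 2 ^ a ≤ 1 / (1 + twice q), as a < 2 ^ a.
  a : ℕ → ℕ
  a q = 2 ℕ.* suc (twice q)
  close : ∀ {q} m → suc (a q) ℕ.≤ m → Small (twice q) (E m - E (suc (a q)))
  close {q} m 1+a≤m = small-frac (E m - E (suc (a q))) 2 (2 ℕ.^ a q) {{2^≢0 (a q)}}
    (subst (λ m → ∣ E m - E (suc (a q)) ∣ ℚ.≤ ℕ→ℚ 2 * inv2^ (a q)) (ℕP.m+[n∸m]≡n 1+a≤m)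
           (eInvPartial-tail (a q) (m ℕ.∸ suc (a q))))
    (ℕP.<⇒≤ (n<2^n (a q)))

dfix-< : ∀ {p r} → p ℕ.< r → dfix p r ≡ 0ℚ
dfix-< {p} {r} p<r with r ℕ.≤ᵇ p | ℕP.≤ᵇ⇒≤ r p
... | false | _   = refl
... | true  | r≤p = ⊥-elim (ℕP.<⇒≱ p<r (r≤p tt))

dfix-≥ : ∀ {p r} → r ℕ.≤ p → dfix p r ≡ ℕ→ℚ (p C r) * der (p ℕ.∸ r)
dfix-≥ {p} {r} r≤p with r ℕ.≤ᵇ p in eq | ℕP.≤⇒≤ᵇ r≤p
... | true | _ rewrite eq = refl

dfix-+ : ∀ r p → dfix (r ℕ.+ p) r ≡ ℕ→ℚ ((r ℕ.+ p) C r) * der p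
dfix-+ r p = trans (dfix-≥ (ℕP.m≤m+n r p)) (cong (λ m → ℕ→ℚ ((r ℕ.+ p) C r) * der m) (ℕP.m+n∸m≡n r p))

-- s-ordered Bell numbers and s-exponential polynomials at -1

module SOrderedBell (n : ℕ) where

  N : ℕ
  N = suc n

  U : ℕ → ℕ → ℚ
  U s k = ℕ→ℚ (sst s n k ℕ.* k !)

  U-pascal : ∀ s k → U (suc s) k ≡ U s k + U s (suc k)
  U-pascal s k = trans (cong ℕ→ℚ (sst*!-pascal s n k)) (ℕ→ℚ-+ (sst s n k ℕ.* k !) (sst s n (suc k) ℕ.* (suc k) !))

  U-vanish : ∀ s k → N ℕ.≤ k → U s k ≡ 0ℚ
  U-vanish s k N≤k rewrite sst-vanish s N≤k = refl

  T : (ℕ → ℚ) → ℕ → ℕ → ℚ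
  T c s m = Σℚ< N (λ k → c k * U s (k ℕ.+ m))

  T-pascal : ∀ c s m → T c (suc s) m ≡ T c s m + T c s (suc m)
  T-pascal c s m = trans (Σ-cong N term) (Σ-distrib-+ N _ _)
    where
    term : ∀ k → c k * U (suc s) (k ℕ.+ m) ≡ c k * U s (k ℕ.+ m) + c k * U s (k ℕ.+ suc m)
    term k = begin
      c k * U (suc s) (k ℕ.+ m)                        ≡⟨ cong (c k *_) (U-pascal s (k ℕ.+ m)) ⟩
      c k * (U s (k ℕ.+ m) + U s (suc (k ℕ.+ m)))      ≡⟨ ℚP.*-distribˡ-+ (c k) _ _ ⟩
      c k * U s (k ℕ.+ m) + c k * U s (suc (k ℕ.+ m))  ≡⟨ cong (λ j → c k * U s (k ℕ.+ m) + c k * U s j) (sym (ℕP.+-suc k m)) ⟩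
      c k * U s (k ℕ.+ m) + c k * U s (k ℕ.+ suc m)    ∎
      where open ≡-Reasoning

  T-vanish : ∀ c s m → N ℕ.≤ m → T c s m ≡ 0ℚ
  T-vanish c s m N≤m = Σ-vanish N (λ k _ →
    trans (cong (c k *_) (U-vanish s (k ℕ.+ m) (ℕP.≤-trans N≤m (ℕP.m≤n+m m k)))) (ℚP.*-zeroʳ (c k)))

  module T-array (c : ℕ → ℚ) = PascalArray N (T c) (T-pascal c) (T-vanish c)

  one : ℕ → ℚ
  one _ = 1ℚ

  w≡T : ∀ s → ℕ→ℚ (w n s) ≡ T one s 0
  w≡T s = trans (ℕ→ℚ-Σ N (λ k → sst s n k ℕ.* k !))
    (Σ-cong N (λ k → trans (sym (ℚP.*-identityˡ _)) (cong (λ j → 1ℚ * U s j) (sym (ℕP.+-identityʳ k)))))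

  φ̃≡T : ∀ s → ℤ→ℚ (φ̃ n s) ≡ T signedInv! s 0
  φ̃≡T s = trans (ℤ→ℚ-Σ N (λ k → sgn k ℤ.* + sst s n k)) (Σ-cong N term)
    where
    term : ∀ k → ℤ→ℚ (sgn k ℤ.* + sst s n k) ≡ signedInv! k * U s (k ℕ.+ 0)
    term k = begin
      ℤ→ℚ (sgn k ℤ.* + sst s n k)
        ≡⟨ ℤ→ℚ-* (sgn k) (+ sst s n k) ⟩
      ℤ→ℚ (sgn k) * ℕ→ℚ (sst s n k)
        ≡⟨ sym (ℚP.*-identityʳ _) ⟩
      ℤ→ℚ (sgn k) * ℕ→ℚ (sst s n k) * 1ℚ
        ≡⟨ cong (ℤ→ℚ (sgn k) * ℕ→ℚ (sst s n k) *_) (sym (ℕ→ℚ*inv!≡1 k)) ⟩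
      ℤ→ℚ (sgn k) * ℕ→ℚ (sst s n k) * (ℕ→ℚ (k !) * inv! k)
        ≡⟨ solve 4 (λ a b c d → a :* b :* (c :* d) := a :* d :* (b :* c)) refl
             (ℤ→ℚ (sgn k)) (ℕ→ℚ (sst s n k)) (ℕ→ℚ (k !)) (inv! k) ⟩
      signedInv! k * (ℕ→ℚ (sst s n k) * ℕ→ℚ (k !))
        ≡⟨ cong (signedInv! k *_) (sym (ℕ→ℚ-* (sst s n k) (k !))) ⟩
      signedInv! k * U s k
        ≡⟨ cong (λ j → signedInv! k * U s j) (sym (ℕP.+-identityʳ k)) ⟩
      signedInv! k * U s (k ℕ.+ 0) ∎
      where open ≡-Reasoning

  Σ-T : ∀ c i M (a : ℕ → ℚ) →
    Σℚ< M (λ j → a j * T c (i ℕ.+ j) 0) ≡ Σℚ< N (λ l → T c i l * Σℚ< M (λ j → a j * ℕ→ℚ (j C l)))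
  Σ-T c i M a = begin
    Σℚ< M (λ j → a j * T c (i ℕ.+ j) 0)
      ≡⟨ Σ-cong M (λ j → cong (a j *_) (T-array.U-binomial c j i 0)) ⟩
    Σℚ< M (λ j → a j * Σℚ< N (λ l → ℕ→ℚ (j C l) * T c i l))
      ≡⟨ Σ-cong M (λ j → trans (*-distribˡ-Σ N (a j) _) (Σ-cong N (λ l → sym (ℚP.*-assoc (a j) _ _)))) ⟩
    Σℚ< M (λ j → Σℚ< N (λ l → a j * ℕ→ℚ (j C l) * T c i l))
      ≡⟨ Σ-comm M N (λ j l → a j * ℕ→ℚ (j C l) * T c i l) ⟩
    Σℚ< N (λ l → Σℚ< M (λ j → a j * ℕ→ℚ (j C l) * T c i l))
      ≡⟨ Σ-cong N (λ l → trans (sym (*-distribʳ-Σ M (T c i l) (λ j → a j * ℕ→ℚ (j C l)))) (ℚP.*-comm _ (T c i l))) ⟩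
    Σℚ< N (λ l → T c i l * Σℚ< M (λ j → a j * ℕ→ℚ (j C l))) ∎
    where open ≡-Reasoning

  inner1≡ : ∀ i M → inner1 n i M ≡ Σℚ< N (λ l → T one i l * (signedInv! l * eInvPartial (M ℕ.∸ l)))
  inner1≡ i M = begin
    inner1 n i M
      ≡⟨ Σ-cong M (λ j → cong (signedInv! j *_) (w≡T (i ℕ.+ j))) ⟩
    Σℚ< M (λ j → signedInv! j * T one (i ℕ.+ j) 0)
      ≡⟨ Σ-T one i M signedInv! ⟩
    Σℚ< N (λ l → T one i l * Σℚ< M (λ j → signedInv! j * ℕ→ℚ (j C l)))
      ≡⟨ Σ-cong N (λ l → cong (T one i l *_) (Σ-signedInv!-C M l)) ⟩
    Σℚ< N (λ l → T one i l * (signedInv! l * eInvPartial (M ℕ.∸ l))) ∎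
    where open ≡-Reasoning

  1-binomPrefix/2^ : ℕ → ℕ → ℚ
  1-binomPrefix/2^ M l = 1ℚ - ℕ→ℚ (binomPrefix M l) * inv2^ M

  inner2≡ : ∀ i M → inner2 n i M ≡ Σℚ< N (λ l → T signedInv! i l * 1-binomPrefix/2^ M l)
  inner2≡ i M = begin
    inner2 n i M
      ≡⟨ Σ-cong M (λ j → trans (cong (_* inv2^ (suc j)) (trans (φ̃≡T (j ℕ.+ i)) (cong (λ s → T signedInv! s 0) (ℕP.+-comm j i))))
                               (ℚP.*-comm _ (inv2^ (suc j)))) ⟩
    Σℚ< M (λ j → inv2^ (suc j) * T signedInv! (i ℕ.+ j) 0)
      ≡⟨ Σ-T signedInv! i M (λ j → inv2^ (suc j)) ⟩
    Σℚ< N (λ l → T signedInv! i l * Σℚ< M (λ j → inv2^ (suc j) * ℕ→ℚ (j C l)))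
      ≡⟨ Σ-cong N (λ l → cong (T signedInv! i l *_) (trans (Σ-cong M (λ j → ℚP.*-comm (inv2^ (suc j)) _)) (Σ-C-inv2^ M l))) ⟩
    Σℚ< N (λ l → T signedInv! i l * 1-binomPrefix/2^ M l) ∎
    where open ≡-Reasoning

  altBinom-T : ∀ c r (F : ℕ → ℚ) → altBinom r (λ i → Σℚ< N (λ l → T c i l * F l)) ≡ Σℚ< N (λ l → T c 0 (l ℕ.+ r) * F l)
  altBinom-T c r F = trans (altBinom-Σ r N (T c) F) (Σ-cong N (λ l → cong (_* F l) (T-array.altBinom-U c r l)))

  u : ℕ → ℚ
  u = U 0

  doubleSum : ℕ → ℚ
  doubleSum r = Σℚ< N (λ l → signedInv! l * Σℚ< N (λ k → u (r ℕ.+ (l ℕ.+ k))))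

  -- d_p = p! Σ_{i ≤ p} (-1)^i / i!, so r! C(r+p, r) d_p = (r+p)! Σ_{i ≤ p} (-1)^i / i!.
  r!*S*dfix : ∀ r p → ℕ→ℚ (r !) * (ℕ→ℚ (stirling2 n (r ℕ.+ p)) * dfix (r ℕ.+ p) r)
                     ≡ u (r ℕ.+ p) * Σℚ< (suc p) signedInv!
  r!*S*dfix r p = begin
    ℕ→ℚ (r !) * (S * dfix (r ℕ.+ p) r)
      ≡⟨ cong (λ x → ℕ→ℚ (r !) * (S * x)) (dfix-+ r p) ⟩
    ℕ→ℚ (r !) * (S * (ℕ→ℚ ((r ℕ.+ p) C r) * (ℕ→ℚ (p !) * P)))
      ≡⟨ solve 5 (λ a b c d e → a :* (b :* (c :* (d :* e))) := b :* (c :* (a :* d)) :* e) refl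
           (ℕ→ℚ (r !)) S (ℕ→ℚ ((r ℕ.+ p) C r)) (ℕ→ℚ (p !)) P ⟩
    S * (ℕ→ℚ ((r ℕ.+ p) C r) * (ℕ→ℚ (r !) * ℕ→ℚ (p !))) * P
      ≡⟨ cong (λ x → S * x * P)
              (sym (trans (ℕ→ℚ-* ((r ℕ.+ p) C r) _) (cong (ℕ→ℚ ((r ℕ.+ p) C r) *_) (ℕ→ℚ-* (r !) (p !))))) ⟩
    S * ℕ→ℚ (((r ℕ.+ p) C r) ℕ.* (r ! ℕ.* p !)) * P
      ≡⟨ cong (λ m → S * ℕ→ℚ m * P) ([m+n]Cm*m!*n!≡[m+n]! r p) ⟩
    S * ℕ→ℚ ((r ℕ.+ p) !) * P
      ≡⟨ cong (_* P) (sym (ℕ→ℚ-* (stirling2 n (r ℕ.+ p)) ((r ℕ.+ p) !))) ⟩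
    u (r ℕ.+ p) * P ∎
    where
    open ≡-Reasoning
    S = ℕ→ℚ (stirling2 n (r ℕ.+ p))
    P = Σℚ< (suc p) signedInv!

  r!*w̃r≡doubleSum : ∀ r → ℕ→ℚ (r !) * w̃r n r ≡ doubleSum r
  r!*w̃r≡doubleSum r = begin
    ℕ→ℚ (r !) * w̃r n r
      ≡⟨ *-distribˡ-Σ N (ℕ→ℚ (r !)) (λ p → ℕ→ℚ (stirling2 n p) * dfix p r) ⟩
    Σℚ< N f
      ≡⟨ sym (Σ-extend N r f f-vanish-above) ⟩
    Σℚ< (N ℕ.+ r) f
      ≡⟨ cong (λ m → Σℚ< m f) (ℕP.+-comm N r) ⟩
    Σℚ< (r ℕ.+ N) f
      ≡⟨ Σ-drop r N f f-vanish-below ⟩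
    Σℚ< N (λ p → f (r ℕ.+ p))
      ≡⟨ Σ-cong N (r!*S*dfix r) ⟩
    Σℚ< N (λ p → u (r ℕ.+ p) * Σℚ< (suc p) signedInv!)
      ≡⟨ Σ-triangle N signedInv! (λ p → u (r ℕ.+ p)) ⟩
    Σℚ< N (λ l → signedInv! l * Σℚ< (N ℕ.∸ l) (λ k → u (r ℕ.+ (l ℕ.+ k))))
      ≡⟨ Σ-cong< N (λ l l<N → cong (signedInv! l *_) (full-range l (ℕP.<⇒≤ l<N))) ⟩
    doubleSum r ∎
    where
    open ≡-Reasoning
    f : ℕ → ℚ
    f p = ℕ→ℚ (r !) * (ℕ→ℚ (stirling2 n p) * dfix p r)
    f-vanish-above : ∀ i → f (N ℕ.+ i) ≡ 0ℚ
    f-vanish-above i rewrite sst-vanish 0 (ℕP.m≤m+n N i) =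
      trans (cong (ℕ→ℚ (r !) *_) (ℚP.*-zeroˡ (dfix (N ℕ.+ i) r))) (ℚP.*-zeroʳ (ℕ→ℚ (r !)))
    f-vanish-below : ∀ p → p ℕ.< r → f p ≡ 0ℚ
    f-vanish-below p p<r rewrite dfix-< p<r =
      trans (cong (ℕ→ℚ (r !) *_) (ℚP.*-zeroʳ (ℕ→ℚ (stirling2 n p)))) (ℚP.*-zeroʳ (ℕ→ℚ (r !)))
    full-range : ∀ l → l ℕ.≤ N → Σℚ< (N ℕ.∸ l) (λ k → u (r ℕ.+ (l ℕ.+ k))) ≡ Σℚ< N (λ k → u (r ℕ.+ (l ℕ.+ k)))
    full-range l l≤N = sym (trans (cong (λ m → Σℚ< m (λ k → u (r ℕ.+ (l ℕ.+ k)))) (sym (ℕP.m∸n+n≡m l≤N)))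
                                  (Σ-extend (N ℕ.∸ l) l (λ k → u (r ℕ.+ (l ℕ.+ k))) (λ i → U-vanish 0 _ (N≤ i))))
      where
      N≤ : ∀ i → N ℕ.≤ r ℕ.+ (l ℕ.+ (N ℕ.∸ l ℕ.+ i))
      N≤ i = ℕP.≤-trans (ℕP.m≤m+n N i)
               (ℕP.≤-trans (ℕP.≤-reflexive (trans (cong (ℕ._+ i) (sym (ℕP.m+[n∸m]≡n l≤N))) (ℕP.+-assoc l (N ℕ.∸ l) i)))
                           (ℕP.m≤n+m _ r))

  Σ-T-one≡doubleSum : ∀ r → Σℚ< N (λ l → T one 0 (l ℕ.+ r) * signedInv! l) ≡ doubleSum r
  Σ-T-one≡doubleSum r = Σ-cong N (λ l → trans (ℚP.*-comm _ (signedInv! l)) (cong (signedInv! l *_)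
    (Σ-cong N (λ k → trans (ℚP.*-identityˡ _) (cong u (reindex k l r))))))
    where
    reindex : ∀ k l r → k ℕ.+ (l ℕ.+ r) ≡ r ℕ.+ (l ℕ.+ k)
    reindex = solve-∀

  Σ-T-signedInv!≡doubleSum : ∀ r → Σℚ< N (λ l → T signedInv! 0 (l ℕ.+ r)) ≡ doubleSum r
  Σ-T-signedInv!≡doubleSum r = begin
    Σℚ< N (λ l → Σℚ< N (λ k → signedInv! k * u (k ℕ.+ (l ℕ.+ r))))
      ≡⟨ Σ-comm N N (λ l k → signedInv! k * u (k ℕ.+ (l ℕ.+ r))) ⟩
    Σℚ< N (λ k → Σℚ< N (λ l → signedInv! k * u (k ℕ.+ (l ℕ.+ r))))
      ≡⟨ Σ-cong N (λ k → sym (*-distribˡ-Σ N (signedInv! k) (λ l → u (k ℕ.+ (l ℕ.+ r))))) ⟩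
    Σℚ< N (λ k → signedInv! k * Σℚ< N (λ l → u (k ℕ.+ (l ℕ.+ r))))
      ≡⟨ Σ-cong N (λ k → cong (signedInv! k *_) (Σ-cong N (λ l → cong u (reindex k l r)))) ⟩
    doubleSum r ∎
    where
    open ≡-Reasoning
    reindex : ∀ k l r → k ℕ.+ (l ℕ.+ r) ≡ r ℕ.+ (k ℕ.+ l)
    reindex = solve-∀

  Σ-*[1-binomPrefix/2^]→Σ : ∀ (K : ℕ → ℚ) → Null (λ M → Σℚ< N (λ l → K l * 1-binomPrefix/2^ M l) - Σℚ< N K)
  Σ-*[1-binomPrefix/2^]→Σ K = null-cong difference
    (null-neg (null-Σ N (λ l M → K l * B/2^ M l) (λ l → null-* (K l) (null-binomPrefix/2^ l))))
    where
    B/2^ : ℕ → ℕ → ℚ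
    B/2^ M l = ℕ→ℚ (binomPrefix M l) * inv2^ M
    difference : ∀ M → - Σℚ< N (λ l → K l * B/2^ M l) ≡ Σℚ< N (λ l → K l * 1-binomPrefix/2^ M l) - Σℚ< N K
    difference M = begin
      - Σℚ< N (λ l → K l * B/2^ M l)
        ≡⟨ Σ-distrib-neg N (λ l → K l * B/2^ M l) ⟩
      Σℚ< N (λ l → - (K l * B/2^ M l))
        ≡⟨ Σ-cong N (λ l → solve 2 (λ k b → :- (k :* b) := k :* (con 1ℚ :- b) :- k) refl (K l) (B/2^ M l)) ⟩
      Σℚ< N (λ l → K l * 1-binomPrefix/2^ M l - K l)
        ≡⟨ Σ-distrib-sub N (λ l → K l * 1-binomPrefix/2^ M l) K ⟩
      Σℚ< N (λ l → K l * 1-binomPrefix/2^ M l) - Σℚ< N K ∎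
      where open ≡-Reasoning

  inner1-isCauchy : ∀ i → IsCauchy (inner1 n i)
  inner1-isCauchy i = cauchy⇒isCauchy (inner1 n i) (cauchy-cong (λ M → sym (inner1≡ i M))
    (cauchy-Σ N _ (λ l → cauchy-* (T one i l) (cauchy-* (signedInv! l) (cauchy-∸ l cauchy-eInvPartial)))))

  inner2-isCauchy : ∀ i → IsCauchy (inner2 n i)
  inner2-isCauchy i = cauchy⇒isCauchy (inner2 n i) (cauchy-cong (λ M → sym (inner2≡ i M))
    (null⇒cauchy (Σℚ< N (T signedInv! i)) (Σ-*[1-binomPrefix/2^]→Σ (T signedInv! i))))

  altBinom-inner1-sameLimit : ∀ r → SameLimit (λ M → altBinom r (λ i → inner1 n i M))
                                              (λ M → ℕ→ℚ (r !) * w̃r n r * eInvPartial M)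
  altBinom-inner1-sameLimit r = null⇒sameLimit (λ M → altBinom r (λ i → inner1 n i M)) (λ M → ℕ→ℚ (r !) * w̃r n r * E M)
    (null-cong difference (null-Σ N (λ l M → K l * signedInv! l * (E (M ℕ.∸ l) - E M))
                                    (λ l → null-* (K l * signedInv! l) (null-eInvPartial-∸ l))))
    where
    E = eInvPartial
    K : ℕ → ℚ
    K l = T one 0 (l ℕ.+ r)
    difference : ∀ M → Σℚ< N (λ l → K l * signedInv! l * (E (M ℕ.∸ l) - E M))
                     ≡ altBinom r (λ i → inner1 n i M) - ℕ→ℚ (r !) * w̃r n r * E M
    difference M = sym (begin
      altBinom r (λ i → inner1 n i M) - ℕ→ℚ (r !) * w̃r n r * E M
        ≡⟨ cong₂ (λ a b → a - b * E M)
                 (trans (altBinom-cong r (λ i → inner1≡ i M)) (altBinom-T one r (λ l → signedInv! l * E (M ℕ.∸ l))))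
                 (trans (r!*w̃r≡doubleSum r) (sym (Σ-T-one≡doubleSum r))) ⟩
      Σℚ< N (λ l → K l * (signedInv! l * E (M ℕ.∸ l))) - Σℚ< N (λ l → K l * signedInv! l) * E M
        ≡⟨ cong (λ x → Σℚ< N (λ l → K l * (signedInv! l * E (M ℕ.∸ l))) - x) (*-distribʳ-Σ N (E M) (λ l → K l * signedInv! l)) ⟩
      Σℚ< N (λ l → K l * (signedInv! l * E (M ℕ.∸ l))) - Σℚ< N (λ l → K l * signedInv! l * E M)
        ≡⟨ sym (Σ-distrib-sub N _ _) ⟩
      Σℚ< N (λ l → K l * (signedInv! l * E (M ℕ.∸ l)) - K l * signedInv! l * E M)
        ≡⟨ Σ-cong N (λ l → solve 4 (λ k e a b → k :* (e :* a) :- k :* e :* b := k :* e :* (a :- b)) refl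
                                      (K l) (signedInv! l) (E (M ℕ.∸ l)) (E M)) ⟩
      Σℚ< N (λ l → K l * signedInv! l * (E (M ℕ.∸ l) - E M)) ∎)
      where open ≡-Reasoning

  altBinom-inner2-convergesTo : ∀ r → ConvergesTo (λ M → altBinom r (λ i → inner2 n i M)) (ℕ→ℚ (r !) * w̃r n r)
  altBinom-inner2-convergesTo r = null⇒convergesTo (λ M → altBinom r (λ i → inner2 n i M)) (ℕ→ℚ (r !) * w̃r n r)
    (null-cong (λ M → cong₂ _-_ (sym (trans (altBinom-cong r (λ i → inner2≡ i M)) (altBinom-T signedInv! r (1-binomPrefix/2^ M))))
                                (trans (Σ-T-signedInv!≡doubleSum r) (sym (r!*w̃r≡doubleSum r))))
               (Σ-*[1-binomPrefix/2^]→Σ (λ l → T signedInv! 0 (l ℕ.+ r))))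

-- The identities hold for n = 0 as well.
mainTheorem7 : (n : ℕ) → 1 ≤ n →
    ((r : ℕ) →
      ((∀ i → i ≤ r → IsCauchy (inner1 n i))
        × SameLimit (λ M → altBinom r (λ i → inner1 n i M))
                    (λ M → ℕ→ℚ (r !) * w̃r n r * eInvPartial M))
      × ((∀ i → i ≤ r → IsCauchy (inner2 n i))
        × ConvergesTo (λ M → altBinom r (λ i → inner2 n i M))
                      (ℕ→ℚ (r !) * w̃r n r)))
    × (SameLimit (inner1 n 0) (λ M → w̃ n * eInvPartial M)
      × ConvergesTo (inner2 n 0) (w̃ n))
mainTheorem7 n _ =
    (λ r → ((λ i _ → inner1-isCauchy i) , altBinom-inner1-sameLimit r)
         , ((λ i _ → inner2-isCauchy i) , altBinom-inner2-convergesTo r))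
  , sameLimit-cong (λ M → altBinom-zero (λ i → inner1 n i M)) (λ M → cong (_* eInvPartial M) (ℚP.*-identityˡ (w̃ n)))
                   (altBinom-inner1-sameLimit 0)
  , convergesTo-cong (λ M → altBinom-zero (λ i → inner2 n i M)) (ℚP.*-identityˡ (w̃ n)) (altBinom-inner2-convergesTo 0)
  where open SOrderedBell n
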